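{- For all integers $n\ge1$ and $k\ge1$, $e(\delta_{n+2k}/\delta_n)=|\mathsf{FanDyck}(k,n)|$.
   Context: $\delta_m=(m-1,m-2,\dots,1)$. Matrix coordinates: $[\lambda]=\{(i,j):1\le j\le\lambda_i\}$. Excited diagrams: for $D\subseteq[\lambda]$, a cell $(i,j)\in D$ is active if $(i+1,j),(i,j+1),(i+1,j+1)$ all lie in $[\lambda]\setminus D$; an excited move replaces an active cell $(i,j)$ by $(i+1,j+1)$; the excited diagrams of $\lambda/\mu$ are the subsets of $[\lambda]$ obtainable from $[\mu]$ by excited moves, and $e(\lambda/\mu)$ is their number. A Dyck path of length $2n$ is a lattice path from $(0,0)$ to $(2n,0)$ with steps $(1,1)$, $(1,-1)$ never going below the $x$-axis. $\mathsf{FanDyck}(k,n)$ is the set of $k$-fans of Dyck paths: $k$-tuples $(\mathsf{p}_1,\dots,\mathsf{p}_k)$ of Dyck paths of length $2n$ that are noncrossing, i.e. (viewing each path as a function of $x\in[0,2n]$) $\mathsf{p}_1(x)\le \mathsf{p}_2(x)\le\cdots\le\mathsf{p}_k(x)$ for all $x$ (paths may touch). -}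

module Defs where

open import Data.Nat using (ℕ; zero; suc; _+_; _*_; _≤_; _<_)
open import Data.Integer as ℤ using (ℤ; +_; -[1+_])
open import Data.Bool using (Bool; true; false)
open import Data.List using (List; []; _∷_; length; take; map; downFrom; _++_)
open import Data.List.Membership.Propositional using (_∈_; _∉_)
open import Data.Product using (Σ; _×_; _,_; ∃; proj₁)
open import Data.Unit using (⊤)
open import Data.Fin using (Fin)
open import Data.Vec using (Vec; toList) renaming ([] to []ᵛ; _∷_ to _∷ᵛ_)
open import Relation.Binary.PropositionalEquality using (_≡_)

-- A partition is its list of parts λ₁ ≥ λ₂ ≥ ⋯ (trailing parts = 0).
Partition : Set
Partition = List ℕ

-- δ_m = (m-1, m-2, …, 1)
delta : ℕ → Partition
delta zero    = []
delta (suc m) = map suc (downFrom m)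

-- λ_i with 1-based index i (0 if i = 0 or i > length λ)
part : Partition → ℕ → ℕ
part []       _             = 0
part (x ∷ xs) zero          = 0
part (x ∷ xs) (suc zero)    = x
part (x ∷ xs) (suc (suc i)) = part xs (suc i)

Cell : Set
Cell = ℕ × ℕ

InShape : Partition → Cell → Set
InShape lam (i , j) = 1 ≤ i × 1 ≤ j × j ≤ part lam i

rowCells : ℕ → ℕ → List Cell
rowCells i zero    = []
rowCells i (suc r) = rowCells i r ++ ((i , suc r) ∷ [])

cellsFrom : ℕ → Partition → List Cell
cellsFrom i []       = []
cellsFrom i (r ∷ rs) = rowCells i r ++ cellsFrom (suc i) rs

cells : Partition → List Cell
cells mu = cellsFrom 1 mu

Diagram : Set
Diagram = List Cell

Active : Partition → Diagram → Cell → Set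
Active lam D (i , j) =
  (i , j) ∈ D ×
  (InShape lam (suc i , j)     × (suc i , j) ∉ D) ×
  (InShape lam (i , suc j)     × (i , suc j) ∉ D) ×
  (InShape lam (suc i , suc j) × (suc i , suc j) ∉ D)

SameCells : Diagram → Diagram → Set
SameCells D E = ∀ c → (c ∈ D → c ∈ E) × (c ∈ E → c ∈ D)

-- A move replaces an active cell (i,j) by (i+1,j+1): if D has the same
-- cells as (i,j) ∷ R (with (i,j) ∉ R), the result is (i+1,j+1) ∷ R.
data Excited (lam mu : Partition) : Diagram → Set where
  start : Excited lam mu (cells mu)
  move  : ∀ {D R i j} → Excited lam mu D → Active lam D (i , j) →
          (i , j) ∉ R → SameCells D ((i , j) ∷ R) →
          Excited lam mu ((suc i , suc j) ∷ R)

ExcitedDiagram : Partition → Partition → Set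
ExcitedDiagram lam mu = Σ Diagram (Excited lam mu)

_≈ED_ : ∀ {lam mu} → ExcitedDiagram lam mu → ExcitedDiagram lam mu → Set
(D , _) ≈ED (E , _) = SameCells D E

-- HasCard A _≈_ m : there is a bijection  Fin m → A / ≈
HasCard : (A : Set) → (A → A → Set) → ℕ → Set
HasCard A _≈_ m =
  Σ (Fin m → A) λ f →
    (∀ a b → f a ≈ f b → a ≡ b) × (∀ x → ∃ λ a → f a ≈ x)

-- a path of length 2n: true = up step (1,1), false = down step (1,-1)
Path : ℕ → Set
Path n = Vec Bool (2 * n)

height : List Bool → ℤ
height []           = + 0
height (true  ∷ bs) = ℤ.suc (height bs)
height (false ∷ bs) = ℤ.pred (height bs)

-- height of the path at abscissa x = t (t ≤ 2n; for t ≥ 2n, the endpoint)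
heightAt : ∀ {n} → Path n → ℕ → ℤ
heightAt {n} p t = height (take t (toList p))

Dyck : ∀ {n} → Path n → Set
Dyck {n} p = (∀ t → + 0 ℤ.≤ heightAt {n} p t) × heightAt {n} p (2 * n) ≡ + 0

-- p(x) ≤ q(x) for all x ∈ [0,2n]; both are piecewise linear with
-- breakpoints at integers, so it suffices to compare at integers.
Below : ∀ {n} → Path n → Path n → Set
Below {n} p q = ∀ t → heightAt {n} p t ℤ.≤ heightAt {n} q t

BelowHead : ∀ {n k} → Path n → Vec (Path n) k → Set
BelowHead {n} p []ᵛ       = ⊤
BelowHead {n} p (q ∷ᵛ qs) = Below {n} p q

IsFan : ∀ {n k} → Vec (Path n) k → Set
IsFan []ᵛ       = ⊤
IsFan {n} (p ∷ᵛ ps) = Dyck {n} p × BelowHead {n} p ps × IsFan {n} ps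

FanDyck : ℕ → ℕ → Set
FanDyck k n = Σ (Vec (Path n) k) (IsFan {n})

_≈Fan_ : ∀ {k n} → FanDyck k n → FanDyck k n → Set
(P , _) ≈Fan (Q , _) = P ≡ Q

module Submission where

-- A path is read through its prefix counts U p t, the number of up steps
-- among its first t steps; the Dyck and noncrossing conditions become
-- inequalities between prefix counts.  For a fan P and a cell (i , j) of
-- δ_n, the shift of (i , j) is the number of paths with at least n − i + 1
-- up steps among their first n − i + j steps; sliding every cell of δ_n
-- down its diagonal by its shift gives the diagram of the fan.
--
--  * An excited move at the slide of (i , j) amounts to raising a valley
--    (down-up becomes up-down) of one path at position n − i + j, so by
--    induction on moves every excited diagram is a fan diagram; the start
--    δ_n is the diagram of the fan of zigzag paths.
--  * Conversely, lowering a highest peak of a path of height ≥ 2 undoes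
--    such a move, so by induction on the total shift every fan diagram is
--    excited.
--  * Slides keep the order of cells along each diagonal, so a diagram
--    determines the shifts, and the shifts determine the fan.
--
-- Fans are a decidable subset of a finite set; enumerating them without
-- repetitions and transporting the enumeration along P ↦ diagram of P
-- counts both sides.

open import Defs
open import Data.Nat
  using (ℕ; zero; suc; _+_; _*_; _∸_; _≤_; _<_; _>_; _⊓_; z≤n; s≤s; s≤s⁻¹; _≤?_; _≟_;
         _≤′_; ≤′-refl; ≤′-step)
open import Data.Nat.Properties
open import Data.Nat.Induction using (<-rec; <-wellFounded)
open import Data.Nat.Solver using (module +-*-Solver)
open import Data.Integer as ℤ using (_⊖_)
import Data.Integer.Properties as ℤP
open import Data.Bool using (Bool; true; false; not)
import Data.Bool.Properties as Bool
open import Data.Fin using (Fin) renaming (zero to fzero; suc to fsuc)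
open import Data.List
  using (List; []; _∷_; length; take; map; lookup; filter; deduplicate; cartesianProductWith)
open import Data.List.Properties using (length-take; take-all; map-id-local)
open import Data.List.Membership.Propositional using (_∈_; _∉_)
open import Data.List.Membership.Propositional.Properties
  using (∈-lookup; ∈-map⁺; ∈-map⁻; ∈-++⁺ˡ; ∈-++⁺ʳ; ∈-++⁻; ∈-filter⁺; ∈-filter⁻;
         ∈-deduplicate⁺; ∈-deduplicate⁻; ∈-cartesianProductWith⁺)
import Data.List.Relation.Unary.All as All
open import Data.List.Relation.Unary.AllPairs using (_∷_)
open import Data.List.Relation.Unary.Any using (here; there; index)
open import Data.List.Relation.Unary.Any.Properties using (lookup-index)
open import Data.List.Relation.Unary.Unique.Propositional using (Unique)
open import Data.List.Relation.Unary.Unique.DecPropositional.Properties using (deduplicate-!)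
open import Data.Vec using (Vec; toList; replicate) renaming ([] to []ᵛ; _∷_ to _∷ᵛ_)
open import Data.Vec.Properties using (length-toList) renaming (≡-dec to ≡-decᵛ)
open import Data.Product using (Σ; ∃; _×_; _,_; proj₁; proj₂)
open import Data.Product.Properties using () renaming (≡-dec to ≡-dec×)
open import Data.Sum using (_⊎_; inj₁; inj₂)
open import Data.Empty using (⊥; ⊥-elim)
open import Data.Unit using (tt)
open import Function using (_∘_)
open import Induction.WellFounded using (Acc; acc)
open import Relation.Nullary using (¬_; Dec; yes; no; contradiction; ¬?; _×-dec_; _⊎-dec_; map′)
open import Relation.Binary.Definitions using (DecidableEquality; Tri; tri<; tri≈; tri>)
open import Relation.Binary.PropositionalEquality
  using (_≡_; _≢_; refl; sym; trans; cong; cong₂; subst; subst₂; module ≡-Reasoning)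

lookup-injective : ∀ {A : Set} {L : List A} → Unique L →
                   ∀ i j → lookup L i ≡ lookup L j → i ≡ j
lookup-injective (_ ∷ _)       fzero    fzero    _ = refl
lookup-injective (x≢ ∷ _)      fzero    (fsuc j) e = ⊥-elim (All.lookup x≢ (∈-lookup j) e)
lookup-injective (x≢ ∷ _)      (fsuc i) fzero    e = ⊥-elim (All.lookup x≢ (∈-lookup i) (sym e))
lookup-injective (_ ∷ unique)  (fsuc i) (fsuc j) e = cong fsuc (lookup-injective unique i j e)

record Enumeration (V : Set) (P : V → Set) : Set where
  field
    list     : List V
    unique   : Unique list
    sound    : ∀ {v} → v ∈ list → P v
    complete : ∀ {v} → P v → v ∈ list

enumerate : ∀ {V : Set} {P : V → Set} → DecidableEquality V → (∀ v → Dec (P v)) →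
            (everything : List V) → (∀ v → v ∈ everything) → Enumeration V P
enumerate _≟_ P? everything all∈ = record
  { list     = deduplicate _≟_ (filter P? everything)
  ; unique   = deduplicate-! _≟_ (filter P? everything)
  ; sound    = λ v∈ → proj₂ (∈-filter⁻ P? {xs = everything}
                                  (∈-deduplicate⁻ _≟_ (filter P? everything) v∈))
  ; complete = λ {v} Pv → ∈-deduplicate⁺ _≟_ (∈-filter⁺ P? (all∈ v) Pv)
  }

hasCard-via : ∀ {V B : Set} {P : V → Set} {_≈_ : B → B → Set} →
  (∀ {x y z} → x ≈ y → y ≈ z → x ≈ z) →
  (E : Enumeration V P) (φ : ∀ v → P v → B) →
  (∀ {v w p q} → φ v p ≈ φ w q → v ≡ w) →
  (∀ {v} (p q : P v) → φ v p ≈ φ v q) →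
  (∀ b → Σ V λ v → Σ (P v) λ p → φ v p ≈ b) →
  HasCard B _≈_ (length (Enumeration.list E))
hasCard-via {B = B} {P = P} {_≈_ = _≈_} ≈-trans E φ injective proof-irrelevant onto =
  entry , (λ i j e → lookup-injective unique i j (injective e)) , preimage
  where
  open Enumeration E
  entry : Fin (length list) → B
  entry i = φ (lookup list i) (sound (∈-lookup i))
  transport : ∀ {v w} (p : P v) → v ≡ w → (q : P w) → φ w q ≈ φ v p
  transport p refl q = proof-irrelevant q p
  preimage : ∀ b → Σ (Fin (length list)) λ i → entry i ≈ b
  preimage b with onto b
  ... | v , p , φv≈b = index (complete p) ,
        ≈-trans (transport p (lookup-index (complete p)) _) φv≈b

vectors : ∀ {A : Set} → List A → (l : ℕ) → List (Vec A l)
vectors xs zero    = []ᵛ ∷ []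
vectors xs (suc l) = cartesianProductWith _∷ᵛ_ xs (vectors xs l)

∈-vectors : ∀ {A : Set} {xs : List A} → (∀ a → a ∈ xs) → ∀ {l} (v : Vec A l) → v ∈ vectors xs l
∈-vectors all∈ []ᵛ       = here refl
∈-vectors all∈ (a ∷ᵛ v) = ∈-cartesianProductWith⁺ _∷ᵛ_ (all∈ a) (∈-vectors all∈ v)

bools : List Bool
bools = true ∷ false ∷ []

∈-bools : ∀ b → b ∈ bools
∈-bools true  = here refl
∈-bools false = there (here refl)

double-suc : ∀ u → 2 * suc u ≡ suc (suc (2 * u))
double-suc u = cong suc (+-suc u (u + 0))

half≤ : ∀ {a b} → 2 * a ≤ suc (2 * b) → a ≤ b
half≤ {zero}          _ = z≤n
half≤ {suc a} {zero}  h rewrite double-suc a = contradiction h λ { (s≤s ()) }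
half≤ {suc a} {suc b} h rewrite double-suc a | double-suc b = s≤s (half≤ (s≤s⁻¹ (s≤s⁻¹ h)))

∸-suc : ∀ {N m} → suc m ≤ N → N ∸ m ≡ suc (N ∸ suc m)
∸-suc {suc N} {zero}  _         = refl
∸-suc {suc N} {suc m} (s≤s m<N) = ∸-suc m<N

argmax : (f : ℕ → ℕ) (B : ℕ) → Σ ℕ λ x → x ≤ B × (∀ y → y ≤ B → f y ≤ f x)
argmax f zero = 0 , z≤n , λ { .zero z≤n → ≤-refl }
argmax f (suc B) with argmax f B
... | x , x≤B , max with f (suc B) ≤? f x
...   | yes fB≤ = x , m≤n⇒m≤1+n x≤B , max'
  where
  max' : ∀ y → y ≤ suc B → f y ≤ f x
  max' y y≤ with m≤n⇒m<n∨m≡n y≤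
  ... | inj₁ y<  = max y (s≤s⁻¹ y<)
  ... | inj₂ refl = fB≤
...   | no  fB≰ = suc B , ≤-refl , max'
  where
  max' : ∀ y → y ≤ suc B → f y ≤ f (suc B)
  max' y y≤ with m≤n⇒m<n∨m≡n y≤
  ... | inj₁ y<  = ≤-trans (max y (s≤s⁻¹ y<)) (<⇒≤ (≰⇒> fB≰))
  ... | inj₂ refl = ≤-refl

valley-bound : ∀ {b j N} → j ≤ suc b → suc (suc b) ≤ N → suc (suc (b + j)) ≤ 2 * N
valley-bound {b} {j} {N} j≤ 2+b≤N = ≤-trans (s≤s (s≤s (+-monoʳ-≤ b j≤)))
  (≤-trans (m≤m+n _ 1) (≤-trans (≤-reflexive (doubled b)) (*-monoʳ-≤ 2 2+b≤N)))
  where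
  doubled : ∀ b → suc (suc (b + suc b)) + 1 ≡ 2 * suc (suc b)
  doubled = solve 1 (λ b → (con 2 :+ (b :+ (con 1 :+ b))) :+ con 1 := con 2 :* (con 2 :+ b)) refl
    where open +-*-Solver

corner-sum : ∀ i j s → suc (i + s) + suc (j + s) ≡ (i + j) + 2 * suc s
corner-sum = solve 3 (λ i j s → (con 1 :+ (i :+ s)) :+ (con 1 :+ (j :+ s))
                              := (i :+ j) :+ con 2 :* (con 1 :+ s)) refl
  where open +-*-Solver

-- moving d steps along a diagonal does not change the number of steps read
diagonal-steps : ∀ N i j d → i + d ≤ N → N ∸ (i + d) + (j + d) ≡ N ∸ i + j
diagonal-steps N i j d i+d≤N = begin
  N ∸ (i + d) + (j + d)   ≡⟨ cong (_+ (j + d)) (sym (∸-+-assoc N i d)) ⟩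
  N ∸ i ∸ d + (j + d)     ≡⟨ cong (N ∸ i ∸ d +_) (+-comm j d) ⟩
  N ∸ i ∸ d + (d + j)     ≡⟨ sym (+-assoc (N ∸ i ∸ d) d j) ⟩
  N ∸ i ∸ d + d + j       ≡⟨ cong (_+ j) (m∸n+n≡m d≤N∸i) ⟩
  N ∸ i + j               ∎
  where
  open ≡-Reasoning
  d≤N∸i : d ≤ N ∸ i
  d≤N∸i = subst (_≤ N ∸ i) (m+n∸m≡n i d) (∸-monoˡ-≤ i i+d≤N)

same-diagonal : ∀ p q r s t u → p + t ≡ q + u → r + t ≡ s + u → p + s ≡ r + q
same-diagonal p q r s t u rows cols = +-cancelʳ-≡ (t + u) (p + s) (r + q) (begin
  p + s + (t + u)        ≡⟨ solve 4 (λ p s t u → (p :+ s) :+ (t :+ u) := (p :+ t) :+ (s :+ u)) refl p s t u ⟩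
  (p + t) + (s + u)      ≡⟨ cong₂ _+_ rows (sym cols) ⟩
  (q + u) + (r + t)      ≡⟨ solve 4 (λ q u r t → (q :+ u) :+ (r :+ t) := (r :+ q) :+ (t :+ u)) refl q u r t ⟩
  r + q + (t + u)        ∎)
  where
  open ≡-Reasoning
  open +-*-Solver

up : Bool → ℕ
up true  = 1
up false = 0

up≤1 : ∀ b → up b ≤ 1
up≤1 true  = s≤s z≤n
up≤1 false = z≤n

up-injective : ∀ {a b} → up a ≡ up b → a ≡ b
up-injective {true}  {true}  _ = refl
up-injective {false} {false} _ = refl
up-injective {true}  {false} ()
up-injective {false} {true}  ()

ups : List Bool → ℕ
ups []       = 0
ups (b ∷ bs) = up b + ups bs

upsTo : List Bool → ℕ → ℕ
upsTo l t = ups (take t l)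

-- up b for the step b in (0-based) position t, 0 past the end
stepAt : List Bool → ℕ → ℕ
stepAt []       _       = 0
stepAt (b ∷ bs) zero    = up b
stepAt (b ∷ bs) (suc t) = stepAt bs t

stepAt≤1 : ∀ l t → stepAt l t ≤ 1
stepAt≤1 []      t       = z≤n
stepAt≤1 (b ∷ l) zero    = up≤1 b
stepAt≤1 (b ∷ l) (suc t) = stepAt≤1 l t

upsTo-suc : ∀ l t → upsTo l (suc t) ≡ upsTo l t + stepAt l t
upsTo-suc []      zero    = refl
upsTo-suc []      (suc t) = refl
upsTo-suc (b ∷ l) zero    = +-comm (up b) 0
upsTo-suc (b ∷ l) (suc t) =
  trans (cong (up b +_) (upsTo-suc l t)) (sym (+-assoc (up b) (upsTo l t) (stepAt l t)))

upsTo-step : ∀ l t → upsTo l (suc t) ≡ upsTo l t ⊎ upsTo l (suc t) ≡ suc (upsTo l t)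
upsTo-step l t with stepAt l t | stepAt≤1 l t | upsTo-suc l t
... | zero  | _       | e = inj₁ (trans e (+-identityʳ _))
... | suc _ | s≤s z≤n | e = inj₂ (trans e (+-comm _ 1))

upsTo-step≤ : ∀ l t → upsTo l t ≤ upsTo l (suc t)
upsTo-step≤ l t with upsTo-step l t
... | inj₁ e = ≤-reflexive (sym e)
... | inj₂ e = ≤-trans (n≤1+n _) (≤-reflexive (sym e))

upsTo-step≥ : ∀ l t → upsTo l (suc t) ≤ suc (upsTo l t)
upsTo-step≥ l t with upsTo-step l t
... | inj₁ e = ≤-trans (≤-reflexive e) (n≤1+n _)
... | inj₂ e = ≤-reflexive e

upsTo-mono : ∀ l {t t'} → t ≤ t' → upsTo l t ≤ upsTo l t'
upsTo-mono l {t} {t'} t≤t' = go (≤⇒≤′ t≤t')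
  where
  go : ∀ {t'} → t ≤′ t' → upsTo l t ≤ upsTo l t'
  go ≤′-refl        = ≤-refl
  go (≤′-step t≤t') = ≤-trans (go t≤t') (upsTo-step≤ l _)

upsTo≤ : ∀ l t → upsTo l t ≤ t
upsTo≤ []      zero    = z≤n
upsTo≤ []      (suc t) = z≤n
upsTo≤ (b ∷ l) zero    = z≤n
upsTo≤ (b ∷ l) (suc t) = +-mono-≤ (up≤1 b) (upsTo≤ l t)

upsTo-saturates : ∀ l t → length l ≤ t → upsTo l t ≡ ups l
upsTo-saturates l t len≤t = cong ups (take-all t l len≤t)

U : ∀ {l} → Vec Bool l → ℕ → ℕ
U v = upsTo (toList v)

U-injective : ∀ {l} (v w : Vec Bool l) → (∀ y → y ≤ l → U v y ≡ U w y) → v ≡ w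
U-injective []ᵛ       []ᵛ       _ = refl
U-injective (a ∷ᵛ v) (b ∷ᵛ w) same = cong₂ _∷ᵛ_ a≡b (U-injective v w same-tail)
  where
  a≡b : a ≡ b
  a≡b = up-injective (trans (sym (+-identityʳ (up a))) (trans (same 1 (s≤s z≤n)) (+-identityʳ (up b))))
  same-tail : ∀ y → y ≤ _ → U v y ≡ U w y
  same-tail y y≤ = +-cancelˡ-≡ (up a) _ _
    (trans (same (suc y) (s≤s y≤)) (cong (λ c → up c + U w y) (sym a≡b)))

-- exchanging the steps in (0-based) positions m and m+1
swap : ∀ {l} → ℕ → Vec Bool l → Vec Bool l
swap zero    []ᵛ              = []ᵛ
swap zero    (a ∷ᵛ []ᵛ)       = a ∷ᵛ []ᵛ
swap zero    (a ∷ᵛ b ∷ᵛ v)    = b ∷ᵛ a ∷ᵛ v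
swap (suc m) []ᵛ              = []ᵛ
swap (suc m) (a ∷ᵛ v)         = a ∷ᵛ swap m v

swap-elsewhere : ∀ {l} m (v : Vec Bool l) y → y ≢ suc m → U (swap m v) y ≡ U v y
swap-elsewhere zero    []ᵛ           y             _  = refl
swap-elsewhere zero    (a ∷ᵛ []ᵛ)    y             _  = refl
swap-elsewhere zero    (a ∷ᵛ b ∷ᵛ v) zero          _  = refl
swap-elsewhere zero    (a ∷ᵛ b ∷ᵛ v) (suc zero)    ne = contradiction refl ne
swap-elsewhere zero    (a ∷ᵛ b ∷ᵛ v) (suc (suc y)) _  =
  trans (sym (+-assoc (up b) (up a) (U v y)))
        (trans (cong (_+ U v y) (+-comm (up b) (up a))) (+-assoc (up a) (up b) (U v y)))
swap-elsewhere (suc m) []ᵛ           y             _  = refl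
swap-elsewhere (suc m) (a ∷ᵛ v)      zero          _  = refl
swap-elsewhere (suc m) (a ∷ᵛ v)      (suc y)       ne =
  cong (up a +_) (swap-elsewhere m v y (λ e → ne (cong suc e)))

swap-between : ∀ {l} m (v : Vec Bool l) → suc m < l →
               U (swap m v) (suc m) ≡ U v m + stepAt (toList v) (suc m)
swap-between zero    (a ∷ᵛ b ∷ᵛ v) _         = +-identityʳ (up b)
swap-between zero    (a ∷ᵛ []ᵛ)    (s≤s ())
swap-between (suc m) (a ∷ᵛ v)      (s≤s m<l) =
  trans (cong (up a +_) (swap-between m v m<l)) (sym (+-assoc (up a) (U v m) _))

swap-at : ∀ {l} m (v : Vec Bool l) → suc m < l →
          U (swap m v) (suc m) ≡ U v m + (U v (suc (suc m)) ∸ U v (suc m))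
swap-at m v m<l = trans (swap-between m v m<l)
  (cong (U v m +_) (sym (trans (cong (_∸ U v (suc m)) (upsTo-suc (toList v) (suc m)))
                               (m+n∸m≡n (U v (suc m)) _))))

zigzag : Bool → (l : ℕ) → Vec Bool l
zigzag b zero    = []ᵛ
zigzag b (suc l) = b ∷ᵛ zigzag (not b) l

zigzag-U : ∀ l y → y ≤ l →
  (y ≤ 2 * U (zigzag true l) y × 2 * U (zigzag true l) y ≤ suc y) ×
  (2 * U (zigzag false l) y ≤ y × y ≤ suc (2 * U (zigzag false l) y))
zigzag-U l       zero    _         = (z≤n , z≤n) , (z≤n , z≤n)
zigzag-U (suc l) (suc y) (s≤s y≤l) with zigzag-U l y y≤l
... | (≤up , up≤) , (down≤ , ≤down) =
  (subst (suc y ≤_) (sym (double-suc _)) (s≤s ≤down) ,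
   subst (_≤ suc (suc y)) (sym (double-suc _)) (s≤s (s≤s down≤))) ,
  (up≤ , s≤s ≤up)

height-ups : ∀ l → height l ≡ 2 * ups l ⊖ length l
height-ups []          = refl
height-ups (true ∷ l)  = begin
  ℤ.suc (height l)                           ≡⟨ cong ℤ.suc (height-ups l) ⟩
  ℤ.+ 1 ℤ.+ (2 * ups l ⊖ length l)           ≡⟨ ℤP.distribʳ-⊖-+-pos 1 (2 * ups l) (length l) ⟩
  suc (2 * ups l) ⊖ length l                 ≡⟨ sym (ℤP.[1+m]⊖[1+n]≡m⊖n (suc (2 * ups l)) (length l)) ⟩
  suc (suc (2 * ups l)) ⊖ suc (length l)     ≡⟨ cong (_⊖ suc (length l)) (sym (*-distribˡ-+ 2 1 (ups l))) ⟩
  2 * (1 + ups l) ⊖ suc (length l)           ∎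
  where open ≡-Reasoning
height-ups (false ∷ l) = begin
  ℤ.pred (height l)                          ≡⟨ cong ℤ.pred (height-ups l) ⟩
  ℤ.-[1+ 0 ] ℤ.+ (2 * ups l ⊖ length l)      ≡⟨ ℤP.distribʳ-⊖-+-neg 0 (2 * ups l) (length l) ⟩
  2 * ups l ⊖ suc (length l)                 ∎
  where open ≡-Reasoning

⊖-reflectsˡ-≤ : ∀ c {a a'} → a ⊖ c ℤ.≤ a' ⊖ c → a ≤ a'
⊖-reflectsˡ-≤ c {a} {a'} h with a ≤? a'
... | yes a≤a' = a≤a'
... | no  a≰a' = contradiction h (ℤP.<⇒≱ (ℤP.⊖-monoˡ-< c (≰⇒> a≰a')))

0≤⊖⇒ : ∀ {a b} → ℤ.+ 0 ℤ.≤ a ⊖ b → b ≤ a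
0≤⊖⇒ {a} {b} h = ⊖-reflectsˡ-≤ b (subst (ℤ._≤ a ⊖ b) (sym (ℤP.n⊖n≡0 b)) h)

⇒0≤⊖ : ∀ {a b} → b ≤ a → ℤ.+ 0 ℤ.≤ a ⊖ b
⇒0≤⊖ {a} {b} b≤a = subst (ℤ._≤ a ⊖ b) (ℤP.n⊖n≡0 b) (ℤP.⊖-monoˡ-≤ b b≤a)

⊖≡0⇒ : ∀ {a b} → a ⊖ b ≡ ℤ.+ 0 → a ≡ b
⊖≡0⇒ {a} {b} e = ≤-antisym
  (⊖-reflectsˡ-≤ b (subst (ℤ._≤ b ⊖ b) (sym e) (ℤP.≤-reflexive (sym (ℤP.n⊖n≡0 b)))))
  (0≤⊖⇒ (ℤP.≤-reflexive (sym e)))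

indicator : ∀ {A : Set} → Dec A → ℕ
indicator (yes _) = 1
indicator (no _)  = 0

indicator≤1 : ∀ {A : Set} (a? : Dec A) → indicator a? ≤ 1
indicator≤1 (yes _) = ≤-refl
indicator≤1 (no _)  = z≤n

indicator-mono : ∀ {A B : Set} (a? : Dec A) (b? : Dec B) → (A → B) → indicator a? ≤ indicator b?
indicator-mono (yes a) (yes _) _   = ≤-refl
indicator-mono (yes a) (no ¬b) a→b = contradiction (a→b a) ¬b
indicator-mono (no _)  _       _   = z≤n

indicator-yes : ∀ {A : Set} (a? : Dec A) → A → indicator a? ≡ 1
indicator-yes (yes _) _ = refl
indicator-yes (no ¬a) a = contradiction a ¬a

indicator-no : ∀ {A : Set} (a? : Dec A) → ¬ A → indicator a? ≡ 0
indicator-no (yes a) ¬a = contradiction a ¬a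
indicator-no (no _)  _  = refl

indicator-forced : ∀ {A : Set} (a? : Dec A) {c K} → c ≤ K → K < indicator a? + c → A
indicator-forced (yes a) _   _ = a
indicator-forced (no _)  c≤K K< = contradiction K< (≤⇒≯ c≤K)

∈-rowCells⁻ : ∀ r x {i j} → (i , j) ∈ rowCells r x → i ≡ r × 1 ≤ j × j ≤ x
∈-rowCells⁻ r (suc x) c∈ with ∈-++⁻ (rowCells r x) c∈
... | inj₁ c∈′ = let (i≡ , 1≤j , j≤) = ∈-rowCells⁻ r x c∈′ in i≡ , 1≤j , m≤n⇒m≤1+n j≤
... | inj₂ (here refl) = refl , s≤s z≤n , ≤-refl

∈-rowCells⁺ : ∀ r x {j} → 1 ≤ j → j ≤ x → (r , j) ∈ rowCells r x
∈-rowCells⁺ r (suc x) 1≤j j≤ with m≤n⇒m<n∨m≡n j≤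
... | inj₁ j<    = ∈-++⁺ˡ (∈-rowCells⁺ r x 1≤j (s≤s⁻¹ j<))
... | inj₂ refl  = ∈-++⁺ʳ (rowCells r x) (here refl)
∈-rowCells⁺ r zero 1≤j j≤ = contradiction (≤-trans 1≤j j≤) λ ()

∈-cellsFrom⁻ : ∀ r lam {i j} → (i , j) ∈ cellsFrom r lam →
               Σ ℕ λ d → i ≡ r + d × 1 ≤ j × j ≤ part lam (suc d)
∈-cellsFrom⁻ r (x ∷ xs) c∈ with ∈-++⁻ (rowCells r x) c∈
... | inj₁ c∈row = let (i≡ , 1≤j , j≤) = ∈-rowCells⁻ r x c∈row
                   in 0 , trans i≡ (sym (+-identityʳ r)) , 1≤j , j≤
... | inj₂ c∈rest = let (d , i≡ , 1≤j , j≤) = ∈-cellsFrom⁻ (suc r) xs c∈rest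
                    in suc d , trans i≡ (sym (+-suc r d)) , 1≤j , j≤

∈-cellsFrom⁺ : ∀ r lam d {j} → 1 ≤ j → j ≤ part lam (suc d) → (r + d , j) ∈ cellsFrom r lam
∈-cellsFrom⁺ r []       d       1≤j j≤ = contradiction (≤-trans 1≤j j≤) λ ()
∈-cellsFrom⁺ r (x ∷ xs) zero    1≤j j≤ rewrite +-identityʳ r = ∈-++⁺ˡ (∈-rowCells⁺ r x 1≤j j≤)
∈-cellsFrom⁺ r (x ∷ xs) (suc d) 1≤j j≤ rewrite +-suc r d =
  ∈-++⁺ʳ (rowCells r x) (∈-cellsFrom⁺ (suc r) xs d 1≤j j≤)

∈cells⇒inShape : ∀ lam {c} → c ∈ cells lam → InShape lam c
∈cells⇒inShape lam c∈ with ∈-cellsFrom⁻ 1 lam c∈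
... | d , refl , 1≤j , j≤ = s≤s z≤n , 1≤j , j≤

inShape⇒∈cells : ∀ lam {c} → InShape lam c → c ∈ cells lam
inShape⇒∈cells lam {suc d , j} (_ , 1≤j , j≤) = ∈-cellsFrom⁺ 1 lam d 1≤j j≤

Staircase : ℕ → Cell → Set
Staircase N (i , j) = 1 ≤ i × 1 ≤ j × i + j ≤ N

part-δ : ∀ N d → part (delta N) (suc d) ≡ N ∸ suc d
part-δ zero          d       = refl
part-δ (suc zero)    d       = sym (0∸n≡0 d)
part-δ (suc (suc N)) zero    = refl
part-δ (suc (suc N)) (suc d) = part-δ (suc N) d

inShape-δ⇒ : ∀ N {c} → InShape (delta N) c → Staircase N c
inShape-δ⇒ N {suc d , j} (1≤i , 1≤j , j≤) with suc d ≤? N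
... | yes i≤N = 1≤i , 1≤j , ≤-trans (+-monoʳ-≤ (suc d) (subst (j ≤_) (part-δ N d) j≤))
                                    (≤-reflexive (m+[n∸m]≡n i≤N))
... | no  i≰N = contradiction (≤-trans 1≤j (subst (j ≤_) row-empty j≤)) λ ()
  where
  row-empty : part (delta N) (suc d) ≡ 0
  row-empty = trans (part-δ N d) (m≤n⇒m∸n≡0 (<⇒≤ (≰⇒> i≰N)))

staircase⇒inShape-δ : ∀ N {c} → Staircase N c → InShape (delta N) c
staircase⇒inShape-δ N {suc d , j} (1≤i , 1≤j , i+j≤N) =
  1≤i , 1≤j , subst (j ≤_) (sym (part-δ N d))
                      (subst (_≤ N ∸ suc d) (m+n∸m≡n (suc d) j) (∸-monoˡ-≤ (suc d) i+j≤N))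

neighbours-in-δ : ∀ N {i j} → 1 ≤ i → 1 ≤ j → suc i + suc j ≤ N →
  InShape (delta N) (suc i , j) × InShape (delta N) (i , suc j) × InShape (delta N) (suc i , suc j)
neighbours-in-δ N {i} {j} 1≤i 1≤j corner≤ =
  staircase⇒inShape-δ N (s≤s z≤n , 1≤j , ≤-trans (+-monoʳ-≤ (suc i) (n≤1+n j)) corner≤) ,
  staircase⇒inShape-δ N (1≤i , s≤s z≤n , ≤-trans (+-monoˡ-≤ (suc j) (n≤1+n i)) corner≤) ,
  staircase⇒inShape-δ N (s≤s z≤n , s≤s z≤n , corner≤)

↘ : Cell → Cell
↘ (i , j) = suc i , suc j

boundary-shift< : ∀ {N k i₀ j₀ s} → i₀ + j₀ ≡ N →
                  InShape (delta (N + 2 * k)) (↘ (i₀ + s , j₀ + s)) → s < k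
boundary-shift< {N} {k} {i₀} {j₀} {s} boundary inShape =
  *-cancelˡ-≤ 2 (+-cancelˡ-≤ N _ _ (subst (_≤ N + 2 * k) corner
                                          (proj₂ (proj₂ (inShape-δ⇒ (N + 2 * k) inShape)))))
  where
  corner : suc (i₀ + s) + suc (j₀ + s) ≡ N + 2 * suc s
  corner = trans (corner-sum i₀ j₀ s) (cong (_+ 2 * suc s) boundary)

≈-refl : ∀ {D} → SameCells D D
≈-refl c = (λ c∈ → c∈) , (λ c∈ → c∈)

≈-sym : ∀ {D E} → SameCells D E → SameCells E D
≈-sym D≈E c = proj₂ (D≈E c) , proj₁ (D≈E c)

≈-trans : ∀ {D E F} → SameCells D E → SameCells E F → SameCells D F
≈-trans D≈E E≈F c = (λ c∈ → proj₁ (E≈F c) (proj₁ (D≈E c) c∈)) ,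
                    (λ c∈ → proj₂ (D≈E c) (proj₂ (E≈F c) c∈))

_≟ᶜ_ : (c d : Cell) → Dec (c ≡ d)
_≟ᶜ_ = ≡-dec× _≟_ _≟_

remove : Cell → Diagram → Diagram
remove c = filter (λ d → ¬? (d ≟ᶜ c))

∉-remove : ∀ c D → c ∉ remove c D
∉-remove c D c∈ = proj₂ (∈-filter⁻ (λ d → ¬? (d ≟ᶜ c)) {xs = D} c∈) refl

split-at : ∀ {c} D → c ∈ D → SameCells D (c ∷ remove c D)
split-at {c} D c∈D d = to , from
  where
  to : d ∈ D → d ∈ c ∷ remove c D
  to d∈D with d ≟ᶜ c
  ... | yes refl = here refl
  ... | no  d≢c  = there (∈-filter⁺ (λ d → ¬? (d ≟ᶜ c)) d∈D d≢c)
  from : d ∈ c ∷ remove c D → d ∈ D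
  from (here refl) = c∈D
  from (there d∈)  = proj₁ (∈-filter⁻ (λ d → ¬? (d ≟ᶜ c)) {xs = D} d∈)

replace-image : ∀ (C : List Cell) (f f' : Cell → Cell) {c₀} (R : Diagram) → c₀ ∈ C →
  (∀ {c} → c ∈ C → c ≢ c₀ → f' c ≡ f c) →
  (∀ {c c'} → c ∈ C → c' ∈ C → f c ≡ f c' → c ≡ c') →
  f c₀ ∉ R → SameCells (map f C) (f c₀ ∷ R) → SameCells (map f' C) (f' c₀ ∷ R)
replace-image C f f' {c₀} R c₀∈ agree injective fc₀∉R image d = to , from
  where
  to : d ∈ map f' C → d ∈ f' c₀ ∷ R
  to d∈ with ∈-map⁻ f' d∈
  ... | c , c∈ , refl with c ≟ᶜ c₀
  ...   | yes refl = here refl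
  ...   | no  c≢c₀ with proj₁ (image (f c)) (∈-map⁺ f c∈)
  ...     | here fc≡  = contradiction (injective c∈ c₀∈ fc≡) c≢c₀
  ...     | there fc∈ = there (subst (_∈ R) (sym (agree c∈ c≢c₀)) fc∈)
  from : d ∈ f' c₀ ∷ R → d ∈ map f' C
  from (here refl) = ∈-map⁺ f' c₀∈
  from (there d∈R) with ∈-map⁻ f (proj₂ (image d) (there d∈R))
  ... | c , c∈ , refl with c ≟ᶜ c₀
  ...   | yes refl = contradiction d∈R fc₀∉R
  ...   | no  c≢c₀ = subst (_∈ map f' C) (agree c∈ c≢c₀) (∈-map⁺ f' c∈)

active-≈ : ∀ {lam D E c} → SameCells D E → Active lam D c → Active lam E c
active-≈ D≈E (c∈ , (s₁ , ∉₁) , (s₂ , ∉₂) , (s₃ , ∉₃)) =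
  proj₁ (D≈E _) c∈ ,
  (s₁ , ∉₁ ∘ proj₂ (D≈E _)) , (s₂ , ∉₂ ∘ proj₂ (D≈E _)) , (s₃ , ∉₃ ∘ proj₂ (D≈E _))

total : (Cell → ℕ) → List Cell → ℕ
total w []       = 0
total w (c ∷ cs) = w c + total w cs

total-≤ : ∀ {w w'} cs → (∀ {c} → c ∈ cs → w c ≤ w' c) → total w cs ≤ total w' cs
total-≤ []       _  = z≤n
total-≤ (c ∷ cs) w≤ = +-mono-≤ (w≤ (here refl)) (total-≤ cs (w≤ ∘ there))

total-< : ∀ {w w' c₀} cs → (∀ {c} → c ∈ cs → w c ≤ w' c) → c₀ ∈ cs → w c₀ < w' c₀ →
          total w cs < total w' cs
total-< (c ∷ cs) w≤ (here refl) w< = +-mono-<-≤ w< (total-≤ cs (w≤ ∘ there))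
total-< (c ∷ cs) w≤ (there c₀∈) w< = +-mono-≤-< (w≤ (here refl)) (total-< cs (w≤ ∘ there) c₀∈ w<)

module Fans (n : ℕ) where

  U-clamp : ∀ (p : Path n) t → U p t ≡ U p (t ⊓ (2 * n))
  U-clamp p t with t ≤? 2 * n
  ... | yes t≤ = cong (U p) (sym (m≤n⇒m⊓n≡m t≤))
  ... | no  t≰ = trans (upsTo-saturates (toList p) t (subst (_≤ t) (sym (length-toList p)) t≥))
                       (sym (trans (cong (U p) (m≥n⇒m⊓n≡n t≥))
                                   (upsTo-saturates (toList p) (2 * n) (≤-reflexive (length-toList p)))))
    where
    t≥ : 2 * n ≤ t
    t≥ = <⇒≤ (≰⇒> t≰)

  heightAt-U : ∀ (p : Path n) t → heightAt {n} p t ≡ 2 * U p t ⊖ (t ⊓ (2 * n))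
  heightAt-U p t = trans (height-ups (take t (toList p)))
    (cong (2 * U p t ⊖_) (trans (length-take t (toList p)) (cong (t ⊓_) (length-toList p))))

  Dyckᵁ : Path n → Set
  Dyckᵁ p = (∀ t → t ≤ 2 * n → t ≤ 2 * U p t) × U p (2 * n) ≡ n

  fromDyck : ∀ p → Dyck {n} p → Dyckᵁ p
  fromDyck p (nonneg , returns) = above , *-cancelˡ-≡ _ n 2 (⊖≡0⇒ (trans (sym end) returns))
    where
    above : ∀ t → t ≤ 2 * n → t ≤ 2 * U p t
    above t t≤ = 0≤⊖⇒ (subst (ℤ.+ 0 ℤ.≤_)
      (trans (heightAt-U p t) (cong (2 * U p t ⊖_) (m≤n⇒m⊓n≡m t≤))) (nonneg t))
    end : heightAt {n} p (2 * n) ≡ 2 * U p (2 * n) ⊖ (2 * n)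
    end = trans (heightAt-U p (2 * n)) (cong (2 * U p (2 * n) ⊖_) (⊓-idem (2 * n)))

  toDyck : ∀ p → Dyckᵁ p → Dyck {n} p
  toDyck p (above , returns) = nonneg , ends
    where
    clamped : ∀ t → heightAt {n} p t ≡ 2 * U p (t ⊓ (2 * n)) ⊖ (t ⊓ (2 * n))
    clamped t = trans (heightAt-U p t) (cong (λ u → 2 * u ⊖ (t ⊓ (2 * n))) (U-clamp p t))
    nonneg : ∀ t → ℤ.+ 0 ℤ.≤ heightAt {n} p t
    nonneg t = subst (ℤ.+ 0 ℤ.≤_) (sym (clamped t)) (⇒0≤⊖ (above _ (m⊓n≤n t (2 * n))))
    ends : heightAt {n} p (2 * n) ≡ ℤ.+ 0
    ends = trans (clamped (2 * n))
      (trans (cong₂ (λ u v → 2 * u ⊖ v) (trans (cong (U p) (⊓-idem (2 * n))) returns) (⊓-idem (2 * n)))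
             (ℤP.n⊖n≡0 (2 * n)))

  fromBelow : ∀ p q → Below {n} p q → ∀ t → U p t ≤ U q t
  fromBelow p q below t = *-cancelˡ-≤ 2 (⊖-reflectsˡ-≤ (t ⊓ (2 * n))
    (subst₂ ℤ._≤_ (heightAt-U p t) (heightAt-U q t) (below t)))

  toBelow : ∀ p q → (∀ t → U p t ≤ U q t) → Below {n} p q
  toBelow p q ≤U t = subst₂ ℤ._≤_ (sym (heightAt-U p t)) (sym (heightAt-U q t))
    (ℤP.⊖-monoˡ-≤ (t ⊓ (2 * n)) (*-monoʳ-≤ 2 (≤U t)))

  U≤n : ∀ p → Dyckᵁ p → ∀ t → U p t ≤ n
  U≤n p (_ , returns) t = subst (U p t ≤_) returns
    (≤-trans (≤-reflexive (U-clamp p t)) (upsTo-mono (toList p) (m⊓n≤n t (2 * n))))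

  -- Being a fan is decidable: all conditions only involve t ≤ 2n.
  private
    upTo2n? : ∀ {P : ℕ → Set} → (∀ t → Dec (P t)) → Dec (∀ t → t ≤ 2 * n → P t)
    upTo2n? P? = map′ (λ all t t≤ → all {t} (s≤s t≤)) (λ all {t} t< → all t (s≤s⁻¹ t<))
                      (allUpTo? P? (suc (2 * n)))

  dyck? : ∀ p → Dec (Dyck {n} p)
  dyck? p = map′ (toDyck p) (fromDyck p) (upTo2n? (λ t → t ≤? 2 * U p t) ×-dec (U p (2 * n) ≟ n))

  below? : ∀ p q → Dec (Below {n} p q)
  below? p q = map′ (λ ≤U → toBelow p q λ t → subst₂ _≤_ (sym (U-clamp p t)) (sym (U-clamp q t))
                                                 (≤U _ (m⊓n≤n t (2 * n))))
                    (λ below t _ → fromBelow p q below t)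
                    (upTo2n? (λ t → U p t ≤? U q t))

  belowHead? : ∀ {k} p (ps : Vec (Path n) k) → Dec (BelowHead {n} p ps)
  belowHead? p []ᵛ      = yes tt
  belowHead? p (q ∷ᵛ _) = below? p q

  fan? : ∀ {k} (P : Vec (Path n) k) → Dec (IsFan {n} P)
  fan? []ᵛ       = yes tt
  fan? (p ∷ᵛ ps) = dyck? p ×-dec belowHead? p ps ×-dec fan? ps

  -- #above P x θ : the number of paths of P with at least θ up steps among
  -- the first x steps.  These counts are the shifts of the cells of the
  -- excited diagram attached to a fan.
  #above : ∀ {k} → Vec (Path n) k → ℕ → ℕ → ℕ
  #above []ᵛ       x θ = 0
  #above (p ∷ᵛ ps) x θ = indicator (θ ≤? U p x) + #above ps x θ

  #above≤ : ∀ {k} (P : Vec (Path n) k) x θ → #above P x θ ≤ k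
  #above≤ []ᵛ       x θ = z≤n
  #above≤ (p ∷ᵛ ps) x θ = +-mono-≤ (indicator≤1 (θ ≤? U p x)) (#above≤ ps x θ)

  #above-mono : ∀ {k} (P : Vec (Path n) k) {x θ x' θ'} →
                (∀ (p : Path n) → θ ≤ U p x → θ' ≤ U p x') → #above P x θ ≤ #above P x' θ'
  #above-mono []ᵛ       _   = z≤n
  #above-mono (p ∷ᵛ ps) {x} {θ} {x'} {θ'} imp =
    +-mono-≤ (indicator-mono (θ ≤? U p x) (θ' ≤? U p x') (imp p)) (#above-mono ps imp)

  #above-antitoneθ : ∀ {k} (P : Vec (Path n) k) x {θ θ'} → θ ≤ θ' → #above P x θ' ≤ #above P x θ
  #above-antitoneθ P x θ≤θ' = #above-mono P (λ p → ≤-trans θ≤θ')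

  #above-monoˣ : ∀ {k} (P : Vec (Path n) k) {x x'} θ → x ≤ x' → #above P x θ ≤ #above P x' θ
  #above-monoˣ P θ x≤x' = #above-mono P (λ p θ≤ → ≤-trans θ≤ (upsTo-mono (toList p) x≤x'))

  #above-step : ∀ {k} (P : Vec (Path n) k) x θ → #above P (suc x) (suc θ) ≤ #above P x θ
  #above-step P x θ = #above-mono P (λ p θ< → s≤s⁻¹ (≤-trans θ< (upsTo-step≥ (toList p) x)))

  fan-above-head : ∀ {k} {p} (ps : Vec (Path n) k) → IsFan {n} (p ∷ᵛ ps) →
                   ∀ {x θ} → θ ≤ U p x → #above ps x θ ≡ k
  fan-above-head []ᵛ        _                 _   = refl
  fan-above-head {p = p} (q ∷ᵛ qs) (_ , p≤q , fan) {x} {θ} θ≤ =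
    cong₂ _+_ (indicator-yes (θ ≤? U q x) θ≤q) (fan-above-head qs fan θ≤q)
    where
    θ≤q : θ ≤ U q x
    θ≤q = ≤-trans θ≤ (fromBelow p q p≤q x)

  -- Near the diagonal every Dyck path is high enough: x ≤ 2U(x) forces
  -- θ ≤ U(x) as soon as 2θ ≤ x + 1.
  fan-above-diagonal : ∀ {k} (P : Vec (Path n) k) → IsFan {n} P →
                       ∀ {x θ} → x ≤ 2 * n → 2 * θ ≤ suc x → #above P x θ ≡ k
  fan-above-diagonal []ᵛ       _ _ _ = refl
  fan-above-diagonal (p ∷ᵛ ps) fan@(dyck , _ , fan-ps) {x} {θ} x≤ 2θ≤ =
    cong₂ _+_ (indicator-yes (θ ≤? U p x) θ≤) (fan-above-diagonal ps fan-ps x≤ 2θ≤)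
    where
    θ≤ : θ ≤ U p x
    θ≤ = half≤ (≤-trans 2θ≤ (s≤s (proj₁ (fromDyck p dyck) x x≤)))

  #above-full-head : ∀ {j q} {qs : Vec (Path n) j} {x θ} → #above (q ∷ᵛ qs) x θ ≡ suc j → θ ≤ U q x
  #above-full-head {q = q} {qs} {x} {θ} full =
    indicator-forced (θ ≤? U q x) (#above≤ qs x θ) (≤-reflexive (sym full))

  lowest-not-above : ∀ {k p} {ps : Vec (Path n) k} → IsFan {n} (p ∷ᵛ ps) → ∀ {x θ} →
                     #above (p ∷ᵛ ps) x θ < suc k → ¬ (θ ≤ U p x)
  lowest-not-above {k} {p} {ps} fan {x} {θ} not-full θ≤ = <-irrefl refl
    (subst (_< suc k) (cong₂ _+_ (indicator-yes (θ ≤? U p x) θ≤) (fan-above-head ps fan θ≤)) not-full)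

  #above-tail-< : ∀ {k p} {ps : Vec (Path n) k} → IsFan {n} (p ∷ᵛ ps) → ∀ {x θ y η} →
    ¬ (θ ≤ U p x) → #above ps x θ < k →
    #above (p ∷ᵛ ps) x θ < #above (p ∷ᵛ ps) y η → #above ps x θ < #above ps y η
  #above-tail-< {p = p} {ps} fan {x} {θ} {y} {η} ¬θ≤ not-full lt with θ ≤? U p x | η ≤? U p y
  ... | yes θ≤ | _    = contradiction θ≤ ¬θ≤
  ... | no _   | yes η≤ = subst (#above ps x θ <_) (sym (fan-above-head ps fan η≤)) not-full
  ... | no _   | no _   = lt

  RaisedAt : ℕ → ℕ → Path n → Path n → Set
  RaisedAt x a p p' = (∀ y → y ≢ x → U p' y ≡ U p y) × U p x ≡ a × U p' x ≡ suc a

  raised-higher : ∀ {x a p p'} → RaisedAt x a p p' → ∀ y → U p y ≤ U p' y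
  raised-higher {x} (same , at , at') y with y ≟ x
  ... | yes refl = ≤-trans (≤-reflexive at) (≤-trans (n≤1+n _) (≤-reflexive (sym at')))
  ... | no  y≢x  = ≤-reflexive (sym (same y y≢x))

  raised-threshold : ∀ {x a p p' y θ} → RaisedAt x a p p' → (y ≢ x ⊎ θ ≢ suc a) →
                     θ ≤ U p' y → θ ≤ U p y
  raised-threshold {x} {a} {y = y} {θ} (same , at , at') elsewhere θ≤ with y ≟ x | elsewhere
  ... | no  y≢x  | _          = subst (θ ≤_) (same y y≢x) θ≤
  ... | yes refl | inj₁ y≢y   = contradiction refl y≢y
  ... | yes refl | inj₂ θ≢1+a with m≤n⇒m<n∨m≡n (subst (θ ≤_) at' θ≤)
  ...   | inj₁ θ<1+a = subst (θ ≤_) (sym at) (s≤s⁻¹ θ<1+a)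
  ...   | inj₂ θ≡1+a = contradiction θ≡1+a θ≢1+a

  data Raise (x a : ℕ) : ∀ {k} → Vec (Path n) k → Vec (Path n) k → Set where
    here  : ∀ {k p p'} {ps : Vec (Path n) k} → RaisedAt x a p p' → Raise x a (p ∷ᵛ ps) (p' ∷ᵛ ps)
    there : ∀ {k p} {ps ps' : Vec (Path n) k} → Raise x a ps ps' → Raise x a (p ∷ᵛ ps) (p ∷ᵛ ps')

  #above-raise-elsewhere : ∀ {x a k} {P P' : Vec (Path n) k} → Raise x a P P' →
                           ∀ y θ → (y ≢ x ⊎ θ ≢ suc a) → #above P' y θ ≡ #above P y θ
  #above-raise-elsewhere (here {p = p} {p'} {ps} raised) y θ elsewhere =
    cong (_+ #above ps y θ) (≤-antisym
      (indicator-mono (θ ≤? U p' y) (θ ≤? U p y) (raised-threshold raised elsewhere))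
      (indicator-mono (θ ≤? U p y) (θ ≤? U p' y) (λ θ≤ → ≤-trans θ≤ (raised-higher raised y))))
  #above-raise-elsewhere (there {p = p} raise) y θ elsewhere =
    cong (indicator (θ ≤? U p y) +_) (#above-raise-elsewhere raise y θ elsewhere)

  #above-raise-at : ∀ {x a k} {P P' : Vec (Path n) k} → Raise x a P P' →
                    #above P' x (suc a) ≡ suc (#above P x (suc a))
  #above-raise-at {x} {a} (here {p = p} {p'} (_ , at , at'))
    rewrite indicator-yes (suc a ≤? U p' x) (≤-reflexive (sym at'))
          | indicator-no (suc a ≤? U p x) (λ 1+a≤ → 1+n≰n (subst (suc a ≤_) at 1+a≤)) = refl
  #above-raise-at {x} {a} (there {p = p} raise) =
    trans (cong (indicator (suc a ≤? U p x) +_) (#above-raise-at raise)) (+-suc _ _)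

  belowHead-raise : ∀ {x a k} {p₀ : Path n} {P P' : Vec (Path n) k} →
                    BelowHead {n} p₀ P → Raise x a P P' → BelowHead {n} p₀ P'
  belowHead-raise {p₀ = p₀} below (here {p = p} {p'} raised) =
    toBelow p₀ p' (λ t → ≤-trans (fromBelow p₀ p below t) (raised-higher raised t))
  belowHead-raise below (there _) = below

  belowHead-lower : ∀ {x a k} {p₀ : Path n} {P P' : Vec (Path n) k} →
                    BelowHead {n} p₀ P → Raise x a P' P → U p₀ x ≤ a → BelowHead {n} p₀ P'
  belowHead-lower {x} {p₀ = p₀} below (here {p = p'} {p} (same , at , _)) p₀≤a = toBelow p₀ p' below'
    where
    below' : ∀ t → U p₀ t ≤ U p' t
    below' t with t ≟ x
    ... | yes refl = subst (U p₀ t ≤_) (sym at) p₀≤a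
    ... | no  t≢x  = subst (U p₀ t ≤_) (same t t≢x) (fromBelow p₀ p below t)
  belowHead-lower below (there _) _ = below

  raised-dyck : ∀ {x a p p'} → RaisedAt x a p p' → x ≢ 2 * n → Dyckᵁ p → Dyckᵁ p'
  raised-dyck {p = p} {p'} raised@(same , _ , _) x≢2n (above , returns) =
    (λ t t≤ → ≤-trans (above t t≤) (*-monoʳ-≤ 2 (raised-higher raised t))) ,
    trans (same (2 * n) (λ e → x≢2n (sym e))) returns

  lowered-dyck : ∀ {x a p p'} → RaisedAt x a p' p → x ≢ 2 * n → x ≤ 2 * a → Dyckᵁ p → Dyckᵁ p'
  lowered-dyck {x} {a} {p} {p'} (same , at , _) x≢2n x≤2a (above , returns) =
    above' , trans (sym (same (2 * n) (λ e → x≢2n (sym e)))) returns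
    where
    above' : ∀ t → t ≤ 2 * n → t ≤ 2 * U p' t
    above' t t≤ with t ≟ x
    ... | yes refl = subst (λ u → t ≤ 2 * u) (sym at) x≤2a
    ... | no  t≢x  = subst (λ u → t ≤ 2 * u) (same t t≢x) (above t t≤)

  flip-valley : ∀ p m {a} → suc (suc m) ≤ 2 * n → U p m ≡ a → U p (suc m) ≡ a →
                U p (suc (suc m)) ≡ suc a → RaisedAt (suc m) a p (swap m p)
  flip-valley p m {a} m< at-m at-m+1 at-m+2 =
    (λ y y≢ → swap-elsewhere m p y y≢) , at-m+1 ,
    trans (swap-at m p m<)
          (trans (cong₂ (λ u v → u + (v ∸ U p (suc m))) at-m at-m+2)
                 (trans (cong (λ v → a + (suc a ∸ v)) at-m+1)
                        (trans (cong (a +_) (m+n∸n≡m 1 a)) (+-comm a 1))))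

  flip-peak : ∀ p m {u} → suc (suc m) ≤ 2 * n → U p m ≡ u → U p (suc m) ≡ suc u →
              U p (suc (suc m)) ≡ suc u → RaisedAt (suc m) u (swap m p) p
  flip-peak p m {u} m< at-m at-m+1 at-m+2 =
    (λ y y≢ → sym (swap-elsewhere m p y y≢)) ,
    trans (swap-at m p m<)
          (trans (cong₂ (λ u' v → u' + (v ∸ U p (suc m))) at-m at-m+2)
                 (trans (cong (λ v → u + (suc u ∸ v)) at-m+1)
                        (trans (cong (u +_) (n∸n≡0 (suc u))) (+-identityʳ u)))) ,
    at-m+1

  raise-lowest : ∀ {k} p (ps : Vec (Path n) k) → IsFan {n} (p ∷ᵛ ps) → ∀ m a →
    suc (suc m) ≤ 2 * n → #above ps (suc m) (suc a) ≡ k →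
    U p m ≡ a → U p (suc m) ≡ a → U p (suc (suc m)) ≡ suc a →
    IsFan {n} (swap m p ∷ᵛ ps)
  raise-lowest p ps (dyck , p≤ps , fan-ps) m a m< full at-m at-m+1 at-m+2 =
    toDyck p' (raised-dyck raised (<⇒≢ m<) (fromDyck p dyck)) , below-ps ps p≤ps full , fan-ps
    where
    p' : Path n
    p' = swap m p
    raised : RaisedAt (suc m) a p p'
    raised = flip-valley p m m< at-m at-m+1 at-m+2
    below-ps : ∀ {j} (qs : Vec (Path n) j) → BelowHead {n} p qs →
               #above qs (suc m) (suc a) ≡ j → BelowHead {n} p' qs
    below-ps []ᵛ        _   _    = tt
    below-ps (q ∷ᵛ qs) p≤q full' = toBelow p' q below
      where
      below : ∀ t → U p' t ≤ U q t
      below t with t ≟ suc m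
      ... | yes refl = subst (_≤ U q t) (sym (proj₂ (proj₂ raised)))
                             (#above-full-head {q = q} {qs} {suc m} {suc a} full')
      ... | no  t≢   = subst (_≤ U q t) (sym (proj₁ raised t t≢)) (fromBelow p q p≤q t)

  -- The hypotheses say that fewer paths reach
  -- a + 1 at m + 1 than reach a at m, resp. a + 1 at m + 2; the highest path
  -- not reaching a + 1 at m + 1 then has a valley there, and is raised.
  raise : ∀ {k} (P : Vec (Path n) k) → IsFan {n} P → ∀ m a → suc (suc m) ≤ 2 * n →
          #above P (suc m) (suc a) < #above P m a →
          #above P (suc m) (suc a) < #above P (suc (suc m)) (suc a) →
          Σ (Vec (Path n) k) λ P' → IsFan {n} P' × Raise (suc m) a P P'
  raise []ᵛ _ _ _ _ () _
  raise {suc k} (p ∷ᵛ ps) fan@(dyck , p≤ps , fan-ps) m a m< down up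
    with lowest-not-above fan {suc m} {suc a} (<-≤-trans down (#above≤ (p ∷ᵛ ps) m a))
       | m≤n⇒m<n∨m≡n (#above≤ ps (suc m) (suc a))
  ... | ¬above | inj₂ full =
    swap m p ∷ᵛ ps , raise-lowest p ps fan m a m< full at-m at-m+1 at-m+2 ,
    here (flip-valley p m m< at-m at-m+1 at-m+2)
    where
    count : #above (p ∷ᵛ ps) (suc m) (suc a) ≡ k
    count = trans (cong (_+ _) (indicator-no (suc a ≤? U p (suc m)) ¬above)) full
    a≤ : a ≤ U p m
    a≤ = indicator-forced (a ≤? U p m) (#above≤ ps m a) (subst (_< #above (p ∷ᵛ ps) m a) count down)
    a<m+2 : suc a ≤ U p (suc (suc m))
    a<m+2 = indicator-forced (suc a ≤? U p (suc (suc m))) (#above≤ ps (suc (suc m)) (suc a))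
              (subst (_< #above (p ∷ᵛ ps) (suc (suc m)) (suc a)) count up)
    at-m+1 : U p (suc m) ≡ a
    at-m+1 = ≤-antisym (s≤s⁻¹ (≰⇒> ¬above)) (≤-trans a≤ (upsTo-step≤ (toList p) m))
    at-m : U p m ≡ a
    at-m = ≤-antisym (≤-trans (upsTo-step≤ (toList p) m) (≤-reflexive at-m+1)) a≤
    at-m+2 : U p (suc (suc m)) ≡ suc a
    at-m+2 = ≤-antisym (≤-trans (upsTo-step≥ (toList p) (suc m)) (s≤s (≤-reflexive at-m+1))) a<m+2
  ... | ¬above | inj₁ not-full
    with raise ps fan-ps m a m< (#above-tail-< fan ¬above not-full down)
                                (#above-tail-< fan ¬above not-full up)
  ...   | P' , fan' , raise' = p ∷ᵛ P' , (dyck , belowHead-raise p≤ps raise' , fan') , there raise'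

  -- A path is tall if it reaches height 2, i.e. y + 2 ≤ 2 U(y) for some y.
  Tall : Path n → Set
  Tall p = Σ ℕ λ y → y ≤ 2 * n × suc (suc y) ≤ 2 * U p y

  tall? : ∀ p → Dec (Tall p)
  tall? p = map′ (λ { (y , y< , tall) → y , s≤s⁻¹ y< , tall })
                 (λ { (y , y≤ , tall) → y , s≤s y≤ , tall })
                 (anyUpTo? (λ y → suc (suc y) ≤? 2 * U p y) (suc (2 * n)))

  -- height + 2n at y; it is maximal at a highest point of the path
  level : Path n → ℕ → ℕ
  level p y = 2 * U p y + (2 * n ∸ y)

  level-flat : ∀ p y → suc y ≤ 2 * n → U p (suc y) ≡ U p y → level p y ≡ suc (level p (suc y))
  level-flat p y y< flat = trans (cong₂ (λ u d → 2 * u + d) (sym flat) (∸-suc y<)) (+-suc _ _)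

  level-rise : ∀ p y → suc y ≤ 2 * n → U p (suc y) ≡ suc (U p y) → level p (suc y) ≡ suc (level p y)
  level-rise p y y< rise = trans (cong (λ u → 2 * u + (2 * n ∸ suc y)) rise)
    (trans (cong (_+ (2 * n ∸ suc y)) (double-suc (U p y)))
           (cong suc (trans (sym (+-suc _ _)) (cong (2 * U p y +_) (sym (∸-suc y<))))))

  level-tall : ∀ p y → y ≤ 2 * n → suc (suc (2 * n)) ≤ level p y → suc (suc y) ≤ 2 * U p y
  level-tall p y y≤ high = +-cancelʳ-≤ (2 * n ∸ y) _ _
    (subst (_≤ level p y) (cong (λ N → suc (suc N)) (sym (m+[n∸m]≡n y≤))) high)

  tall-level : ∀ p y → y ≤ 2 * n → suc (suc y) ≤ 2 * U p y → suc (suc (2 * n)) ≤ level p y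
  tall-level p y y≤ tall =
    subst (_≤ level p y) (cong (λ N → suc (suc N)) (m+[n∸m]≡n y≤)) (+-monoˡ-≤ (2 * n ∸ y) tall)

  -- a peak of height at least 2 at position m + 1
  record Peak (p : Path n) : Set where
    field
      m u    : ℕ
      m<     : suc (suc m) ≤ 2 * n
      at-m   : U p m ≡ u
      at-m+1 : U p (suc m) ≡ suc u
      at-m+2 : U p (suc (suc m)) ≡ suc u
      high   : suc m ≤ 2 * u

  -- A highest point of a tall Dyck path is such a peak.
  highest-peak : ∀ p → Dyckᵁ p → Tall p → Peak p
  highest-peak p (_ , returns) (y₀ , y₀≤ , tall) with argmax (level p) (2 * n)
  ... | x , x≤ , max = at x x≤ max (≤-trans (tall-level p y₀ y₀≤ tall) (max y₀ y₀≤))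
    where
    end-low : level p (2 * n) ≡ 2 * n
    end-low = trans (cong₂ _+_ (cong (2 *_) returns) (n∸n≡0 (2 * n))) (+-identityʳ (2 * n))
    ≰-2+ : ∀ {N} → ¬ (suc (suc N) ≤ N)
    ≰-2+ h = 1+n≰n (≤-trans (n≤1+n _) h)
    at : ∀ x → x ≤ 2 * n → (∀ y → y ≤ 2 * n → level p y ≤ level p x) →
         suc (suc (2 * n)) ≤ level p x → Peak p
    at zero    _  _   high = contradiction high ≰-2+
    at (suc m) x≤ max high = record
      { m = m ; u = U p m ; m< = m< ; at-m = refl ; at-m+1 = up-step ; at-m+2 = down-step
      ; high = s≤s⁻¹ (s≤s⁻¹ (subst (suc (suc (suc m)) ≤_) (trans (cong (2 *_) up-step) (double-suc _))
                                    (level-tall p (suc m) x≤ high))) }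
      where
      m< : suc (suc m) ≤ 2 * n
      m< with m≤n⇒m<n∨m≡n x≤
      ... | inj₁ x<  = x<
      ... | inj₂ x≡ = contradiction (≤-trans high (≤-reflexive (trans (cong (level p) x≡) end-low))) ≰-2+
      up-step : U p (suc m) ≡ suc (U p m)
      up-step with upsTo-step (toList p) m
      ... | inj₂ rise = rise
      ... | inj₁ flat = contradiction (max m (≤-trans (n≤1+n m) x≤))
                          (<⇒≱ (≤-reflexive (sym (level-flat p m (<⇒≤ m<) flat))))
      down-step : U p (suc (suc m)) ≡ suc (U p m)
      down-step with upsTo-step (toList p) (suc m)
      ... | inj₁ flat = trans flat up-step
      ... | inj₂ rise = contradiction (max (suc (suc m)) m<)
                          (<⇒≱ (≤-reflexive (sym (level-rise p (suc m) m< rise))))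

  lower-peak : ∀ p → Dyckᵁ p → (peak : Peak p) →
               let open Peak peak in Dyckᵁ (swap m p) × RaisedAt (suc m) u (swap m p) p
  lower-peak p dyck peak = lowered-dyck raised (<⇒≢ m<) high dyck , raised
    where
    open Peak peak
    raised : RaisedAt (suc m) u (swap m p) p
    raised = flip-peak p m m< at-m at-m+1 at-m+2

  AnyTall : ∀ {k} → Vec (Path n) k → Set
  AnyTall []ᵛ       = ⊥
  AnyTall (p ∷ᵛ ps) = Tall p ⊎ AnyTall ps

  anyTall? : ∀ {k} (P : Vec (Path n) k) → Dec (AnyTall P)
  anyTall? []ᵛ       = no (λ ())
  anyTall? (p ∷ᵛ ps) = tall? p ⊎-dec anyTall? ps

  -- A fan P' from which P arises by raising one path at a peak position m + 1
  -- from a to a + 1; the bounds place the corresponding cell in δ_n.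
  record Lowering {k} (P : Vec (Path n) k) : Set where
    field
      m a         : ℕ
      a≤m         : a ≤ m
      m<2a        : suc m ≤ 2 * a
      a<n         : a < n
      lowered     : Vec (Path n) k
      lowered-fan : IsFan {n} lowered
      raising     : Raise (suc m) a lowered P

  lower-lowest : ∀ {k} p (ps : Vec (Path n) k) → IsFan {n} (p ∷ᵛ ps) → Tall p → Lowering (p ∷ᵛ ps)
  lower-lowest p ps (dyck , p≤ps , fan-ps) tall = record
    { m = m ; a = u ; a≤m = subst (_≤ m) at-m (upsTo≤ (toList p) m) ; m<2a = high
    ; a<n = subst (_≤ n) at-m+1 (U≤n p dyckᵁ (suc m))
    ; lowered = p' ∷ᵛ ps ; lowered-fan = toDyck p' dyck' , below-ps ps p≤ps , fan-ps
    ; raising = here raised }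
    where
    dyckᵁ : Dyckᵁ p
    dyckᵁ = fromDyck p dyck
    peak : Peak p
    peak = highest-peak p dyckᵁ tall
    open Peak peak
    p' : Path n
    p' = swap m p
    dyck' : Dyckᵁ p'
    dyck' = proj₁ (lower-peak p dyckᵁ peak)
    raised : RaisedAt (suc m) u p' p
    raised = proj₂ (lower-peak p dyckᵁ peak)
    below-ps : ∀ {j} (qs : Vec (Path n) j) → BelowHead {n} p qs → BelowHead {n} p' qs
    below-ps []ᵛ        _   = _
    below-ps (q ∷ᵛ _)  p≤q = toBelow p' q (λ t → ≤-trans (raised-higher raised t) (fromBelow p q p≤q t))

  not-tall-low : ∀ p → ¬ Tall p → ∀ {x a} → x ≤ 2 * n → x ≤ 2 * a → U p x ≤ a
  not-tall-low p ¬tall {x} x≤2n x≤2a =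
    half≤ (≤-trans (s≤s⁻¹ (≰⇒> (λ tall-x → ¬tall (x , x≤2n , tall-x)))) (s≤s x≤2a))

  lower : ∀ {k} (P : Vec (Path n) k) → IsFan {n} P → AnyTall P → Lowering P
  lower (p ∷ᵛ ps) fan@(dyck , p≤ps , fan-ps) tall-P with tall? p | tall-P
  ... | yes tall  | _           = lower-lowest p ps fan tall
  ... | no  ¬tall | inj₁ tall   = contradiction tall ¬tall
  ... | no  ¬tall | inj₂ tall-ps = record
    { m = m ; a = a ; a≤m = a≤m ; m<2a = m<2a ; a<n = a<n
    ; lowered = p ∷ᵛ lowered
    ; lowered-fan = dyck , belowHead-lower p≤ps raising p-low , lowered-fan
    ; raising = there raising }
    where
    open Lowering (lower ps fan-ps tall-ps)
    p-low : U p (suc m) ≤ a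
    p-low = not-tall-low p ¬tall (≤-trans m<2a (*-monoʳ-≤ 2 (<⇒≤ a<n))) m<2a

  shift : ∀ {k} → Vec (Path n) k → ℕ → ℕ → ℕ
  shift P i j = #above P (n ∸ i + j) (suc (n ∸ i))

  slide : ∀ {k} → Vec (Path n) k → Cell → Cell
  slide P (i , j) = i + shift P i j , j + shift P i j

  δcells : List Cell
  δcells = cells (delta n)

  fanDiagram : ∀ {k} → Vec (Path n) k → Diagram
  fanDiagram P = map (slide P) δcells

  shift≤ : ∀ {k} (P : Vec (Path n) k) i j → shift P i j ≤ k
  shift≤ P i j = #above≤ P _ _

  shift-down : ∀ {k} (P : Vec (Path n) k) i j → i < n → shift P i j ≤ shift P (suc i) j
  shift-down P i j i<n rewrite ∸-suc i<n = #above-step P (n ∸ suc i + j) (suc (n ∸ suc i))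

  shift-right : ∀ {k} (P : Vec (Path n) k) i j → shift P i j ≤ shift P i (suc j)
  shift-right P i j = #above-monoˣ P (suc (n ∸ i)) (+-monoʳ-≤ (n ∸ i) (n≤1+n j))

  shift-diagonal : ∀ {k} (P : Vec (Path n) k) i j d → i + d ≤ n → shift P i j ≤ shift P (i + d) (j + d)
  shift-diagonal P i j d i+d≤n rewrite diagonal-steps n i j d i+d≤n =
    #above-antitoneθ P (n ∸ i + j) (s≤s (∸-monoʳ-≤ n (m≤m+n i d)))

  slide-row-< : ∀ {k} (P : Vec (Path n) k) a b a' b' → a < a' → a' ≤ n → b + a' ≡ b' + a →
                a + shift P a b < a' + shift P a' b'
  slide-row-< P a b a' b' a<a' a'≤n diag with m≤n⇒∃[o]m+o≡n (<⇒≤ a<a')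
  ... | d , refl = +-mono-<-≤ (m<m+n a d>0) (subst (λ z → shift P a b ≤ shift P (a + d) z) b+d≡b'
                                                    (shift-diagonal P a b d a'≤n))
    where
    b+d≡b' : b + d ≡ b'
    b+d≡b' = +-cancelʳ-≡ a _ _ (trans (trans (+-assoc b d a) (cong (b +_) (+-comm d a))) diag)
    d>0 : 0 < d
    d>0 = +-cancelˡ-< a 0 d (subst (_< a + d) (sym (+-identityʳ a)) a<a')

  slide-row-≤ : ∀ {k} (P : Vec (Path n) k) a b a' b' → a ≤ a' → a' ≤ n → b + a' ≡ b' + a →
                a + shift P a b ≤ a' + shift P a' b'
  slide-row-≤ P a b a' b' a≤a' a'≤n diag with m≤n⇒m<n∨m≡n a≤a'
  ... | inj₁ a<a' = <⇒≤ (slide-row-< P a b a' b' a<a' a'≤n diag)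
  ... | inj₂ refl rewrite +-cancelʳ-≡ a b b' diag = ≤-refl

  slide-injective : ∀ {k} (P : Vec (Path n) k) {i j i' j'} → i ≤ n → i' ≤ n →
                    slide P (i , j) ≡ slide P (i' , j') → (i , j) ≡ (i' , j')
  slide-injective P {i} {j} {i'} {j'} i≤n i'≤n same = by-rows (<-cmp i i')
    where
    diag : i + j' ≡ j + i'
    diag = same-diagonal i i' j j' _ _ (cong proj₁ same) (cong proj₂ same)
    by-rows : Tri (i < i') (i ≡ i') (i > i') → (i , j) ≡ (i' , j')
    by-rows (tri≈ _ refl _) = cong (i ,_) (+-cancelˡ-≡ i j j' (trans (+-comm i j) (sym diag)))
    by-rows (tri< i<i' _ _) = contradiction (cong proj₁ same)
      (<⇒≢ (slide-row-< P i j i' j' i<i' i'≤n (trans (sym diag) (+-comm i j'))))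
    by-rows (tri> _ _ i>i') = contradiction (sym (cong proj₁ same))
      (<⇒≢ (slide-row-< P i' j' i j i>i' i≤n (trans (+-comm j' i) diag)))

  ∈δ⇒ : ∀ {c} → c ∈ δcells → Staircase n c
  ∈δ⇒ c∈ = inShape-δ⇒ n (∈cells⇒inShape (delta n) c∈)

  ⇒∈δ : ∀ {c} → Staircase n c → c ∈ δcells
  ⇒∈δ c = inShape⇒∈cells (delta n) (staircase⇒inShape-δ n c)

  ∈δ⇒row≤ : ∀ {i j} → (i , j) ∈ δcells → i ≤ n
  ∈δ⇒row≤ c∈ = let (_ , _ , i+j≤n) = ∈δ⇒ c∈ in ≤-trans (m≤m+n _ _) i+j≤n

  shift-flat : ∀ {k} (P : Vec (Path n) k) → ¬ AnyTall P → ∀ {i j} → i + j ≤ n → shift P i j ≡ 0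
  shift-flat []ᵛ       _     _      = refl
  shift-flat (p ∷ᵛ ps) ¬tall {i} {j} i+j≤n =
    cong₂ _+_ (indicator-no (suc a ≤? U p x) λ a<U → <⇒≱ a<U p-low)
              (shift-flat ps (¬tall ∘ inj₂) {i} {j} i+j≤n)
    where
    a x : ℕ
    a = n ∸ i
    x = a + j
    x≤2a : x ≤ 2 * a
    x≤2a = +-monoʳ-≤ a (≤-trans (subst (_≤ a) (m+n∸m≡n i j) (∸-monoˡ-≤ i i+j≤n))
                                (≤-reflexive (sym (+-identityʳ a))))
    x≤2n : x ≤ 2 * n
    x≤2n = ≤-trans x≤2a (*-monoʳ-≤ 2 (m∸n≤m n i))
    p-low : U p x ≤ a
    p-low = not-tall-low p (¬tall ∘ inj₁) x≤2n x≤2a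

  fanDiagram-flat : ∀ {k} (P : Vec (Path n) k) → ¬ AnyTall P → fanDiagram P ≡ δcells
  fanDiagram-flat P ¬tall = map-id-local (All.tabulate fixed)
    where
    fixed : ∀ {c} → c ∈ δcells → slide P c ≡ c
    fixed {i , j} c∈ = cong₂ _,_ (trans (cong (i +_) unshifted) (+-identityʳ i))
                                 (trans (cong (j +_) unshifted) (+-identityʳ j))
      where
      unshifted : shift P i j ≡ 0
      unshifted = shift-flat P ¬tall {i} {j} (proj₂ (proj₂ (∈δ⇒ c∈)))

  zigzag-path : Path n
  zigzag-path = zigzag true (2 * n)

  zigzag-dyck : Dyckᵁ zigzag-path
  zigzag-dyck = (λ t t≤ → proj₁ (bounds t t≤)) ,
    ≤-antisym (half≤ (proj₂ (bounds (2 * n) ≤-refl))) (*-cancelˡ-≤ 2 (proj₁ (bounds (2 * n) ≤-refl)))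
    where
    bounds : ∀ t → t ≤ 2 * n → t ≤ 2 * U zigzag-path t × 2 * U zigzag-path t ≤ suc t
    bounds t t≤ = proj₁ (zigzag-U (2 * n) t t≤)

  zigzag-¬tall : ¬ Tall zigzag-path
  zigzag-¬tall (y , y≤ , tall) = <⇒≱ tall (proj₂ (proj₁ (zigzag-U (2 * n) y y≤)))

  flat-fan : ∀ k → Vec (Path n) k
  flat-fan k = replicate k zigzag-path

  flat-fan-isFan : ∀ k → IsFan {n} (flat-fan k)
  flat-fan-isFan zero    = tt
  flat-fan-isFan (suc k) = toDyck zigzag-path zigzag-dyck , below-copies k , flat-fan-isFan k
    where
    below-copies : ∀ k → BelowHead {n} zigzag-path (flat-fan k)
    below-copies zero    = tt
    below-copies (suc k) = toBelow zigzag-path zigzag-path (λ _ → ≤-refl)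

  flat-fan-¬tall : ∀ k → ¬ AnyTall (flat-fan k)
  flat-fan-¬tall zero    ()
  flat-fan-¬tall (suc k) (inj₁ tall) = zigzag-¬tall tall
  flat-fan-¬tall (suc k) (inj₂ tall) = flat-fan-¬tall k tall

  shift-raise-at : ∀ {x a k} {P P' : Vec (Path n) k} → Raise x a P P' →
                   ∀ {i₀ j₀} → n ∸ i₀ ≡ a → n ∸ i₀ + j₀ ≡ x →
                   shift P' i₀ j₀ ≡ suc (shift P i₀ j₀)
  shift-raise-at raise a≡ x≡ rewrite x≡ | a≡ = #above-raise-at raise

  shift-raise-elsewhere : ∀ {x a k} {P P' : Vec (Path n) k} → Raise x a P P' →
    ∀ {i₀ j₀} → i₀ ≤ n → n ∸ i₀ ≡ a → n ∸ i₀ + j₀ ≡ x →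
    ∀ {i j} → i ≤ n → (i , j) ≢ (i₀ , j₀) → shift P' i j ≡ shift P i j
  shift-raise-elsewhere {x} {a} raise {i₀} {j₀} i₀≤n a≡ x≡ {i} {j} i≤n c≢c₀ =
    #above-raise-elsewhere raise (n ∸ i + j) (suc (n ∸ i)) elsewhere
    where
    elsewhere : n ∸ i + j ≢ x ⊎ suc (n ∸ i) ≢ suc a
    elsewhere with n ∸ i ≟ a
    ... | no  a≢ = inj₂ (λ e → a≢ (suc-injective e))
    ... | yes a≡′ = inj₁ λ x≡′ → c≢c₀ (cong₂ _,_ i≡i₀ (+-cancelˡ-≡ (n ∸ i) j j₀
                      (trans x≡′ (trans (sym x≡) (cong (λ r → n ∸ r + j₀) (sym i≡i₀))))))
      where
      i≡i₀ : i ≡ i₀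
      i≡i₀ = ∸-cancelˡ-≡ i≤n i₀≤n (trans a≡′ (sym a≡))

  raise-diagram : ∀ {x a k} {P P' : Vec (Path n) k} → Raise x a P P' →
    ∀ {i₀ j₀} → (i₀ , j₀) ∈ δcells → n ∸ i₀ ≡ a → n ∸ i₀ + j₀ ≡ x →
    ∀ {R} → slide P (i₀ , j₀) ∉ R → SameCells (fanDiagram P) (slide P (i₀ , j₀) ∷ R) →
    SameCells (fanDiagram P') (↘ (slide P (i₀ , j₀)) ∷ R)
  raise-diagram {P = P} {P'} raise {i₀} {j₀} c₀∈ a≡ x≡ {R} ∉R image =
    subst (λ c → SameCells (fanDiagram P') (c ∷ R)) slid-further
      (replace-image δcells (slide P) (slide P') R c₀∈ agree injective ∉R image)
    where
    agree : ∀ {c} → c ∈ δcells → c ≢ (i₀ , j₀) → slide P' c ≡ slide P c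
    agree {i , j} c∈ c≢ = cong₂ (λ s t → i + s , j + t) same same
      where
      same : shift P' i j ≡ shift P i j
      same = shift-raise-elsewhere raise (∈δ⇒row≤ c₀∈) a≡ x≡ (∈δ⇒row≤ c∈) c≢
    injective : ∀ {c c'} → c ∈ δcells → c' ∈ δcells → slide P c ≡ slide P c' → c ≡ c'
    injective {_ , _} {_ , _} c∈ c'∈ = slide-injective P (∈δ⇒row≤ c∈) (∈δ⇒row≤ c'∈)
    slid-further : slide P' (i₀ , j₀) ≡ ↘ (slide P (i₀ , j₀))
    slid-further = trans (cong₂ (λ s t → i₀ + s , j₀ + t) grows grows)
                         (cong₂ _,_ (+-suc i₀ _) (+-suc j₀ _))
      where
      grows : shift P' i₀ j₀ ≡ suc (shift P i₀ j₀)
      grows = shift-raise-at raise {i₀} {j₀} a≡ x≡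

  -- If the cell below the slid cell (i₀ , j₀) is free, the cell below
  -- (i₀ , j₀) in δ_n has a strictly larger shift (otherwise it would slide there).
  below-free : ∀ {k} (P : Vec (Path n) k) {i₀ j₀} → i₀ < n → (suc i₀ , j₀) ∈ δcells →
               (suc (i₀ + shift P i₀ j₀) , j₀ + shift P i₀ j₀) ∉ fanDiagram P →
               shift P i₀ j₀ < shift P (suc i₀) j₀
  below-free P {i₀} {j₀} i₀<n below∈ free = ≤∧≢⇒< (shift-down P i₀ j₀ i₀<n) λ same →
    free (subst (_∈ fanDiagram P) (cong (λ s → suc (i₀ + s) , j₀ + s) (sym same))
                (∈-map⁺ (slide P) below∈))

  right-free : ∀ {k} (P : Vec (Path n) k) {i₀ j₀} → (i₀ , suc j₀) ∈ δcells →
               (i₀ + shift P i₀ j₀ , suc (j₀ + shift P i₀ j₀)) ∉ fanDiagram P →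
               shift P i₀ j₀ < shift P i₀ (suc j₀)
  right-free P {i₀} {j₀} right∈ free = ≤∧≢⇒< (shift-right P i₀ j₀) λ same →
    free (subst (_∈ fanDiagram P) (cong (λ s → i₀ + s , suc (j₀ + s)) (sym same))
                (∈-map⁺ (slide P) right∈))

  -- The cell (i₀ , j₀) of δ_n reads the counts at m + 1 = n − i₀ + j₀ with
  -- threshold a + 1 = n − i₀ + 1; its lower and right neighbours read the
  -- counts at m with threshold a and at m + 2 with threshold a + 1.
  module Reading {k} (P : Vec (Path n) k) {i₀ j₀} (c₀ : Staircase n (i₀ , j₀)) where

    i₀+j₀≤n : i₀ + j₀ ≤ n
    i₀+j₀≤n = proj₂ (proj₂ c₀)

    i₀<n : i₀ < n
    i₀<n = ≤-trans (≤-trans (≤-reflexive (+-comm 1 i₀)) (+-monoʳ-≤ i₀ (proj₁ (proj₂ c₀))))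
                   i₀+j₀≤n

    b a m : ℕ
    b = n ∸ suc i₀
    a = suc b
    m = b + j₀

    a≡ : n ∸ i₀ ≡ a
    a≡ = ∸-suc i₀<n

    x≡ : n ∸ i₀ + j₀ ≡ suc m
    x≡ = cong (_+ j₀) a≡

    j₀≤a : j₀ ≤ a
    j₀≤a = subst₂ _≤_ (m+n∸m≡n i₀ j₀) a≡ (∸-monoˡ-≤ i₀ i₀+j₀≤n)

    a<n : a < n
    a<n = ≤-trans (+-monoˡ-≤ a (proj₁ c₀))
                  (≤-reflexive (trans (cong (i₀ +_) (sym a≡)) (m+[n∸m]≡n (<⇒≤ i₀<n))))

    m<2n : suc (suc m) ≤ 2 * n
    m<2n = valley-bound j₀≤a a<n

    reads-here : shift P i₀ j₀ ≡ #above P (suc m) (suc a)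
    reads-here rewrite a≡ = refl

    reads-below : shift P (suc i₀) j₀ ≡ #above P m a
    reads-below = refl

    reads-right : shift P i₀ (suc j₀) ≡ #above P (suc (suc m)) (suc a)
    reads-right rewrite a≡ = cong (λ y → #above P y (suc a)) (cong suc (+-suc b j₀))

  active-raisable : ∀ {k} (P : Vec (Path n) k) → IsFan {n} P →
    ∀ {i₀ j₀} (c₀ : Staircase n (i₀ , j₀)) →
    Active (delta (n + 2 * k)) (fanDiagram P) (slide P (i₀ , j₀)) →
    let open Reading P c₀ in
    #above P (suc m) (suc a) < #above P m a ×
    #above P (suc m) (suc a) < #above P (suc (suc m)) (suc a)
  active-raisable {k} P fan {i₀} {j₀} c₀@(1≤i₀ , 1≤j₀ , inside)
                  (_ , (_ , below∉) , (_ , right∉) , (corner∈ , _))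
    with m≤n⇒m<n∨m≡n inside
  ... | inj₁ interior =
    subst₂ _<_ reads-here reads-below (below-free P i₀<n (⇒∈δ (s≤s z≤n , 1≤j₀ , interior)) below∉) ,
    subst₂ _<_ reads-here reads-right
      (right-free P (⇒∈δ (1≤i₀ , s≤s z≤n , subst (_≤ n) (sym (+-suc i₀ j₀)) interior)) right∉)
    where open Reading P c₀
  ... | inj₂ boundary = subst (#above P (suc m) (suc a) <_) (sym full-below) here<k ,
                        subst (#above P (suc m) (suc a) <_) (sym full-right) here<k
    where
    open Reading P c₀
    here<k : #above P (suc m) (suc a) < k
    here<k = subst (_< k) reads-here (boundary-shift< boundary corner∈)
    j₀≡a : j₀ ≡ a
    j₀≡a = trans (sym (m+n∸m≡n i₀ j₀)) (trans (cong (_∸ i₀) boundary) a≡)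
    -- on the boundary m + 1 = 2a, where every Dyck path reaches a at m and a + 1 at m + 2
    2a≡ : 2 * a ≡ suc m
    2a≡ = trans (cong (a +_) (+-identityʳ a)) (cong (a +_) (sym j₀≡a))
    full-below : #above P m a ≡ k
    full-below = fan-above-diagonal P fan (≤-trans (n≤1+n m) (<⇒≤ m<2n)) (≤-reflexive 2a≡)
    full-right : #above P (suc (suc m)) (suc a) ≡ k
    full-right = fan-above-diagonal P fan m<2n
      (≤-reflexive (trans (double-suc a) (cong (λ y → suc (suc y)) 2a≡)))

  excited-step : ∀ {k D R i j} (P : Vec (Path n) k) → IsFan {n} P → SameCells D (fanDiagram P) →
    Active (delta (n + 2 * k)) D (i , j) → (i , j) ∉ R → SameCells D ((i , j) ∷ R) →
    Σ (Vec (Path n) k) λ P' → IsFan {n} P' × SameCells ((suc i , suc j) ∷ R) (fanDiagram P')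
  excited-step {k} P fan D≈ active ∉R D≈split with ∈-map⁻ (slide P) (proj₁ (D≈ _) (proj₁ active))
  ... | (i₀ , j₀) , c₀∈ , refl =
    let open Reading P (∈δ⇒ c₀∈)
        (down , up) = active-raisable P fan (∈δ⇒ c₀∈) (active-≈ {delta (n + 2 * k)} D≈ active)
        (P' , fan' , raising) = raise P fan m a m<2n down up
    in P' , fan' , ≈-sym (raise-diagram raising c₀∈ a≡ x≡ ∉R (≈-trans (≈-sym D≈) D≈split))

  excited⇒fan : ∀ {k D} → Excited (delta (n + 2 * k)) (delta n) D →
                Σ (Vec (Path n) k) λ P → IsFan {n} P × SameCells D (fanDiagram P)
  excited⇒fan {k} start =
    flat-fan k , flat-fan-isFan k ,
    subst (SameCells δcells) (sym (fanDiagram-flat (flat-fan k) (flat-fan-¬tall k))) ≈-refl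
  excited⇒fan (move excited active ∉R split) with excited⇒fan excited
  ... | P , fan , D≈ = excited-step P fan D≈ active ∉R split

  -- No cell slides onto (α + t , β + t) when that cell lies strictly between
  -- the slides of (α , β) and (α + 1 , β + 1): slides keep the order along
  -- diagonals.
  gap : ∀ {k} (Q : Vec (Path n) k) α β t → α ≤ n → shift Q α β < t →
        (suc α ≤ n → t < suc (shift Q (suc α) (suc β))) → (α + t , β + t) ∉ fanDiagram Q
  gap Q α β t α≤n lower upper target∈ with ∈-map⁻ (slide Q) target∈
  ... | (a' , b') , c∈ , slid = by-position (a' ≤? α)
    where
    row : a' + shift Q a' b' ≡ α + t
    row = cong proj₁ (sym slid)
    diag : b' + α ≡ β + a'
    diag = trans (sym (same-diagonal a' α b' β _ t row (cong proj₂ (sym slid)))) (+-comm a' β)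
    by-position : Dec (a' ≤ α) → ⊥
    by-position (yes a'≤α) = <⇒≱ (+-monoʳ-< α lower)
      (≤-trans (≤-reflexive (sym row)) (slide-row-≤ Q a' b' α β a'≤α α≤n diag))
    by-position (no a'≰α) =
      <⇒≱ (subst (α + t <_) (+-suc α _) (+-monoʳ-< α (upper (≤-trans α<a' a'≤n))))
      (≤-trans (slide-row-≤ Q (suc α) (suc β) a' b' α<a' a'≤n diag′) (≤-reflexive row))
      where
      α<a' : α < a'
      α<a' = ≰⇒> a'≰α
      a'≤n : a' ≤ n
      a'≤n = ∈δ⇒row≤ c∈
      diag′ : suc β + a' ≡ b' + suc α
      diag′ = trans (cong suc (sym diag)) (sym (+-suc b' α))

  -- The cell (i₀ , j₀) = (n − a , m + 1 − a) of δ_n reads the count at m + 1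
  -- with threshold a + 1, for the position and level of a peak.
  module PeakCell {m a} (a≤m : a ≤ m) (m<2a : suc m ≤ 2 * a) (a<n : a < n) where

    i₀' j₀' i₀ j₀ : ℕ
    i₀' = n ∸ suc a
    j₀' = m ∸ a
    i₀ = suc i₀'
    j₀ = suc j₀'

    i₀≡ : n ∸ a ≡ i₀
    i₀≡ = ∸-suc a<n

    a≡ : n ∸ i₀ ≡ a
    a≡ = trans (cong (n ∸_) (sym i₀≡)) (m∸[m∸n]≡n (<⇒≤ a<n))

    x≡ : n ∸ i₀ + j₀ ≡ suc m
    x≡ = trans (cong (_+ j₀) a≡) (trans (+-suc a j₀') (cong suc (m+[n∸m]≡n a≤m)))

    i₀≤n : i₀ ≤ n
    i₀≤n = subst (_≤ n) i₀≡ (m∸n≤m n a)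

    j₀≤a : j₀ ≤ a
    j₀≤a = subst₂ _≤_ (+-∸-assoc 1 a≤m) 2a∸a≡a (∸-monoˡ-≤ a m<2a)
      where
      2a∸a≡a : 2 * a ∸ a ≡ a
      2a∸a≡a = trans (cong (λ b → a + b ∸ a) (+-identityʳ a)) (m+n∸m≡n a a)

    staircase : Staircase n (i₀ , j₀)
    staircase = s≤s z≤n , s≤s z≤n ,
      ≤-trans (+-monoʳ-≤ i₀ j₀≤a)
              (≤-reflexive (trans (cong (i₀ +_) (sym a≡)) (m+[n∸m]≡n i₀≤n)))

    reads : ∀ {k} (P : Vec (Path n) k) → shift P i₀ j₀ ≡ #above P (suc m) (suc a)
    reads P rewrite x≡ | a≡ = refl

  lowered-active : ∀ {k m a} {Q P : Vec (Path n) k} → Raise (suc m) a Q P →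
    (a≤m : a ≤ m) (m<2a : suc m ≤ 2 * a) (a<n : a < n) →
    let open PeakCell a≤m m<2a a<n in
    Active (delta (n + 2 * k)) (fanDiagram Q) (slide Q (i₀ , j₀))
  lowered-active {k} {m} {a} {Q} {P} raising a≤m m<2a a<n =
    ∈-map⁺ (slide Q) (⇒∈δ staircase) ,
    (proj₁ neighbours ,
     subst (_∉ fanDiagram Q) (cong₂ _,_ (+-suc i₀ s') (+-suc j₀' s')) below∉) ,
    (proj₁ (proj₂ neighbours) ,
     subst (_∉ fanDiagram Q) (cong₂ _,_ (+-suc i₀' s') (+-suc j₀ s')) right∉) ,
    (proj₂ (proj₂ neighbours) ,
     subst (_∉ fanDiagram Q) (cong₂ _,_ (+-suc i₀ s') (+-suc j₀ s')) corner∉)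
    where
    open PeakCell a≤m m<2a a<n
    s' : ℕ
    s' = shift Q i₀ j₀
    grows : shift P i₀ j₀ ≡ suc s'
    grows = shift-raise-at raising {i₀} {j₀} a≡ x≡
    -- the other cells keep their shifts, which dominate the raised shift of (i₀ , j₀)
    above-raised : ∀ {i j} → i ≤ n → (i , j) ≢ (i₀ , j₀) →
                   shift P i₀ j₀ ≤ shift P i j → s' < shift Q i j
    above-raised {i} {j} i≤n c≢ P≤ =
      subst (s' <_) (shift-raise-elsewhere raising i₀≤n a≡ x≡ i≤n c≢)
                    (subst (_≤ shift P i j) grows P≤)
    below∉ : (i₀ + suc s' , j₀' + suc s') ∉ fanDiagram Q
    below∉ = gap Q i₀ j₀' (suc s') i₀≤n (s≤s (shift-right Q i₀ j₀'))
      (λ i₀<n → s≤s (above-raised i₀<n (λ e → 1+n≢n (cong proj₁ e)) (shift-down P i₀ j₀ i₀<n)))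
    right∉ : (i₀' + suc s' , j₀ + suc s') ∉ fanDiagram Q
    right∉ = gap Q i₀' j₀ (suc s') (≤-trans (n≤1+n i₀') i₀≤n)
                 (s≤s (shift-down Q i₀' j₀ i₀≤n))
      (λ _ → s≤s (above-raised i₀≤n (λ e → 1+n≢n (cong proj₂ e)) (shift-right P i₀ j₀)))
    corner∉ : (i₀ + suc s' , j₀ + suc s') ∉ fanDiagram Q
    corner∉ = gap Q i₀ j₀ (suc s') i₀≤n ≤-refl
      (λ i₀<n → s≤s (above-raised i₀<n (λ e → 1+n≢n (cong proj₁ e))
        (subst₂ (λ r c → shift P i₀ j₀ ≤ shift P r c) (+-comm i₀ 1) (+-comm j₀ 1)
                (shift-diagonal P i₀ j₀ 1 (subst (_≤ n) (+-comm 1 i₀) i₀<n)))))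
    corner-sum≤ : suc (i₀ + s') + suc (j₀ + s') ≤ n + 2 * k
    corner-sum≤ = ≤-trans (≤-reflexive (corner-sum i₀ j₀ s'))
      (+-mono-≤ (proj₂ (proj₂ staircase)) (*-monoʳ-≤ 2 (subst (_≤ k) grows (shift≤ P i₀ j₀))))
    neighbours : InShape (delta (n + 2 * k)) (suc (i₀ + s') , j₀ + s') ×
                 InShape (delta (n + 2 * k)) (i₀ + s' , suc (j₀ + s')) ×
                 InShape (delta (n + 2 * k)) (suc (i₀ + s') , suc (j₀ + s'))
    neighbours = neighbours-in-δ (n + 2 * k) (s≤s z≤n) (s≤s z≤n) corner-sum≤

  lowering-step : ∀ {k} {P : Vec (Path n) k} (L : Lowering P) → ∀ {E'} →
    Excited (delta (n + 2 * k)) (delta n) E' → SameCells E' (fanDiagram (Lowering.lowered L)) →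
    Σ Diagram λ E → Excited (delta (n + 2 * k)) (delta n) E × SameCells E (fanDiagram P)
  lowering-step {k} L {E'} excited E'≈ =
    ↘ c ∷ R , move excited (active-≈ {delta (n + 2 * k)} (≈-sym E'≈) active) (∉-remove c E') E'-split ,
    ≈-sym (raise-diagram raising (⇒∈δ staircase) a≡ x≡ (∉-remove c E')
                         (≈-trans (≈-sym E'≈) E'-split))
    where
    open Lowering L
    open PeakCell a≤m m<2a a<n
    c : Cell
    c = slide lowered (i₀ , j₀)
    R : Diagram
    R = remove c E'
    active : Active (delta (n + 2 * k)) (fanDiagram lowered) c
    active = lowered-active raising a≤m m<2a a<n
    E'-split : SameCells E' (c ∷ R)
    E'-split = split-at E' (proj₂ (E'≈ c) (proj₁ active))

  -- the total shift of the cells of δ_n, which lowering decreases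
  weight : ∀ {k} → Vec (Path n) k → ℕ
  weight P = total (λ c → shift P (proj₁ c) (proj₂ c)) δcells

  lowering-lighter : ∀ {k} {P : Vec (Path n) k} (L : Lowering P) → weight (Lowering.lowered L) < weight P
  lowering-lighter {P = P} L = total-< δcells lighter (⇒∈δ staircase) (≤-reflexive (sym grows))
    where
    open Lowering L
    open PeakCell a≤m m<2a a<n
    grows : shift P i₀ j₀ ≡ suc (shift lowered i₀ j₀)
    grows = shift-raise-at raising {i₀} {j₀} a≡ x≡
    lighter : ∀ {c} → c ∈ δcells → shift lowered (proj₁ c) (proj₂ c) ≤ shift P (proj₁ c) (proj₂ c)
    lighter {i , j} c∈ with (i , j) ≟ᶜ (i₀ , j₀)
    ... | yes refl = ≤-trans (n≤1+n _) (≤-reflexive (sym grows))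
    ... | no  c≢   =
      ≤-reflexive (sym (shift-raise-elsewhere raising i₀≤n a≡ x≡ (∈δ⇒row≤ c∈) c≢))

  -- Every fan diagram is an excited diagram: lower peaks until no path is
  -- tall, which leaves the diagram δ_n itself.
  fan⇒excited : ∀ {k} (P : Vec (Path n) k) → IsFan {n} P →
    Σ Diagram λ E → Excited (delta (n + 2 * k)) (delta n) E × SameCells E (fanDiagram P)
  fan⇒excited P fan = go P fan (<-wellFounded (weight P))
    where
    go : ∀ {k} (P : Vec (Path n) k) → IsFan {n} P → Acc _<_ (weight P) →
         Σ Diagram λ E → Excited (delta (n + 2 * k)) (delta n) E × SameCells E (fanDiagram P)
    go P fan (acc smaller) with anyTall? P
    ... | no ¬tall = δcells , start , subst (SameCells δcells) (sym (fanDiagram-flat P ¬tall)) ≈-refl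
    ... | yes tall =
      let L = lower P fan tall
          (E' , excited , E'≈) = go (Lowering.lowered L) (Lowering.lowered-fan L) (smaller (lowering-lighter L))
      in lowering-step L excited E'≈

  AgreeAbove : ∀ {k} → Vec (Path n) k → Vec (Path n) k → ℕ → Set
  AgreeAbove P Q i = ∀ {i'} → i' < i → ∀ {j'} → (i' , j') ∈ δcells → shift P i' j' ≡ shift Q i' j'

  -- The cell of Q at (i , j) slides to the slide of some cell of P on the same
  -- diagonal.
  compare-slides : ∀ {k} (P Q : Vec (Path n) k) → SameCells (fanDiagram P) (fanDiagram Q) →
    ∀ {i j} → (i , j) ∈ δcells → AgreeAbove P Q i →
    shift Q i j ≡ shift P i j ⊎ i + shift P i j < i + shift Q i j
  compare-slides P Q P≈Q {i} {j} c∈ agree-above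
    with ∈-map⁻ (slide P) (proj₂ (P≈Q _) (∈-map⁺ (slide Q) c∈))
  ... | (i₂ , j₂) , c₂∈ , slides = by-rows (<-cmp i₂ i)
    where
    rows : i + shift Q i j ≡ i₂ + shift P i₂ j₂
    rows = cong proj₁ slides
    diag : i + j₂ ≡ j + i₂
    diag = same-diagonal i i₂ j j₂ _ _ rows (cong proj₂ slides)
    by-rows : Tri (i₂ < i) (i₂ ≡ i) (i₂ > i) →
              shift Q i j ≡ shift P i j ⊎ i + shift P i j < i + shift Q i j
    by-rows (tri< i₂<i _ _) = contradiction
      (slide-injective Q (∈δ⇒row≤ c₂∈) (∈δ⇒row≤ c∈)
        (trans (cong (λ s → i₂ + s , j₂ + s) (sym (agree-above i₂<i c₂∈))) (sym slides)))
      (λ e → <-irrefl (cong proj₁ e) i₂<i)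
    by-rows (tri≈ _ refl _) =
      inj₁ (+-cancelˡ-≡ i _ _ (trans rows (cong (λ j' → i + shift P i j') j₂≡j)))
      where
      j₂≡j : j₂ ≡ j
      j₂≡j = +-cancelˡ-≡ i j₂ j (trans diag (+-comm j i))
    by-rows (tri> _ _ i<i₂) = inj₂ (subst (i + shift P i j <_) (sym rows)
      (slide-row-< P i j i₂ j₂ i<i₂ (∈δ⇒row≤ c₂∈) (trans (sym diag) (+-comm i j₂))))

  same-shifts : ∀ {k} (P Q : Vec (Path n) k) → SameCells (fanDiagram P) (fanDiagram Q) →
                ∀ {i j} → (i , j) ∈ δcells → shift P i j ≡ shift Q i j
  same-shifts P Q P≈Q {i} = <-rec (λ i → ∀ {j} → (i , j) ∈ δcells → shift P i j ≡ shift Q i j) step i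
    where
    step : ∀ i → AgreeAbove P Q i → ∀ {j} → (i , j) ∈ δcells → shift P i j ≡ shift Q i j
    step i agree-above c∈ with compare-slides P Q P≈Q c∈ agree-above
                             | compare-slides Q P (≈-sym P≈Q) c∈ (λ i'< c'∈ → sym (agree-above i'< c'∈))
    ... | inj₁ Q≡P  | _          = sym Q≡P
    ... | inj₂ _    | inj₁ P≡Q   = P≡Q
    ... | inj₂ P<Q  | inj₂ Q<P   = contradiction P<Q (<-asym Q<P)

  PeakCountsAgree : ∀ {k} → Vec (Path n) k → Vec (Path n) k → Set
  PeakCountsAgree P Q = ∀ {m u} → u ≤ m → suc m ≤ 2 * u → u < n →
                        #above P (suc m) (suc u) ≡ #above Q (suc m) (suc u)

  -- If such counts agree, the lowest path of the first fan is nowhere above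
  -- that of the second: where it were, all of the first fan would reach a
  -- level the lowest path of the second does not.
  lowest-≤ : ∀ {k p q} {ps qs : Vec (Path n) k} → IsFan {n} (p ∷ᵛ ps) → IsFan {n} (q ∷ᵛ qs) →
             PeakCountsAgree (p ∷ᵛ ps) (q ∷ᵛ qs) → ∀ x → x ≤ 2 * n → U p x ≤ U q x
  lowest-≤ _ _ _ zero _ = z≤n
  lowest-≤ {k} {p} {q} {ps} {qs} fanP@(dyck-p , _) (dyck-q , _) agree (suc m) x≤
    with U p (suc m) ≤? U q (suc m)
  ... | yes p≤q = p≤q
  ... | no  p≰q = contradiction counts 1+n≰n
    where
    u : ℕ
    u = U q (suc m)
    u<p : u < U p (suc m)
    u<p = ≰⇒> p≰q
    u≤m : u ≤ m
    u≤m = s≤s⁻¹ (≤-trans u<p (upsTo≤ (toList p) (suc m)))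
    x≤2u : suc m ≤ 2 * u
    x≤2u = proj₁ (fromDyck q dyck-q) (suc m) x≤
    u<n : u < n
    u<n = ≤-trans u<p (U≤n p (fromDyck p dyck-p) (suc m))
    all-P : suc k ≡ #above (p ∷ᵛ ps) (suc m) (suc u)
    all-P = sym (cong₂ _+_ (indicator-yes (suc u ≤? U p (suc m)) u<p) (fan-above-head ps fanP u<p))
    some-Q : #above (q ∷ᵛ qs) (suc m) (suc u) ≤ k
    some-Q = subst (_≤ k) (sym (cong (_+ #above qs (suc m) (suc u)) q-misses)) (#above≤ qs (suc m) (suc u))
      where
      q-misses : indicator (suc u ≤? U q (suc m)) ≡ 0
      q-misses = indicator-no (suc u ≤? U q (suc m)) 1+n≰n
    counts : suc k ≤ k
    counts = begin
      suc k                            ≡⟨ all-P ⟩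
      #above (p ∷ᵛ ps) (suc m) (suc u) ≡⟨ agree u≤m x≤2u u<n ⟩
      #above (q ∷ᵛ qs) (suc m) (suc u) ≤⟨ some-Q ⟩
      k                                ∎
      where open ≤-Reasoning

  fans-equal : ∀ {k} (P Q : Vec (Path n) k) → IsFan {n} P → IsFan {n} Q → PeakCountsAgree P Q → P ≡ Q
  fans-equal []ᵛ       []ᵛ       _ _ _ = refl
  fans-equal (p ∷ᵛ ps) (q ∷ᵛ qs) fanP fanQ agree =
    cong₂ _∷ᵛ_ p≡q (fans-equal ps qs (proj₂ (proj₂ fanP)) (proj₂ (proj₂ fanQ)) agree-tails)
    where
    p≡q : p ≡ q
    p≡q = U-injective p q λ x x≤ →
      ≤-antisym (lowest-≤ fanP fanQ agree x x≤)
                (lowest-≤ fanQ fanP (λ u≤ m≤ u< → sym (agree u≤ m≤ u<)) x x≤)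
    agree-tails : PeakCountsAgree ps qs
    agree-tails {m} {u} u≤ m≤ u< = +-cancelˡ-≡ (indicator (suc u ≤? U p (suc m))) _ _
      (trans (agree u≤ m≤ u<)
             (cong (λ r → indicator (suc u ≤? U r (suc m)) + #above qs (suc m) (suc u)) (sym p≡q)))

  fanDiagram-injective : ∀ {k} (P Q : Vec (Path n) k) → IsFan {n} P → IsFan {n} Q →
                         SameCells (fanDiagram P) (fanDiagram Q) → P ≡ Q
  fanDiagram-injective P Q fanP fanQ P≈Q = fans-equal P Q fanP fanQ λ u≤m m<2u u<n →
    let open PeakCell u≤m m<2u u<n in
    trans (sym (reads P)) (trans (same-shifts P Q P≈Q (⇒∈δ staircase)) (reads Q))

  fans : ∀ k → Enumeration (Vec (Path n) k) (IsFan {n})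
  fans k = enumerate (≡-decᵛ (≡-decᵛ Bool._≟_)) fan? (vectors (vectors bools (2 * n)) k)
                     (∈-vectors (∈-vectors ∈-bools))

  #fans : ℕ → ℕ
  #fans k = length (Enumeration.list (fans k))

  fan-count : ∀ k → HasCard (FanDyck k n) _≈Fan_ (#fans k)
  fan-count k = hasCard-via trans (fans k) _,_ (λ same → same) (λ _ _ → refl)
                            (λ (P , fan) → P , fan , refl)

  excitedOf : ∀ {k} (P : Vec (Path n) k) → IsFan {n} P → ExcitedDiagram (delta (n + 2 * k)) (delta n)
  excitedOf P fan = proj₁ (fan⇒excited P fan) , proj₁ (proj₂ (fan⇒excited P fan))

  excitedOf≈ : ∀ {k} (P : Vec (Path n) k) (fan : IsFan {n} P) →
               SameCells (proj₁ (excitedOf P fan)) (fanDiagram P)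
  excitedOf≈ P fan = proj₂ (proj₂ (fan⇒excited P fan))

  excited-count : ∀ k → HasCard (ExcitedDiagram (delta (n + 2 * k)) (delta n)) _≈ED_ (#fans k)
  excited-count k = hasCard-via ≈-trans (fans k) excitedOf
    (λ {P} {Q} {fanP} {fanQ} same → fanDiagram-injective P Q fanP fanQ
       (≈-trans (≈-sym (excitedOf≈ P fanP)) (≈-trans same (excitedOf≈ Q fanQ))))
    (λ {P} fan fan' → ≈-trans (excitedOf≈ P fan) (≈-sym (excitedOf≈ P fan')))
    (λ (D , excited) → let (P , fan , D≈) = excited⇒fan excited
                       in P , fan , ≈-trans (excitedOf≈ P fan) (≈-sym D≈))

corollary8p4 : ∀ (n k : ℕ) → 1 ≤ n → 1 ≤ k →
    ∃ λ m → HasCard (ExcitedDiagram (delta (n + 2 * k)) (delta n)) _≈ED_ m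
    × HasCard (FanDyck k n) _≈Fan_ m
corollary8p4 n k _ _ = #fans k , excited-count k , fan-count k
  where open Fans n
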